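{- Let $n\in\mathbb{N}=\{1,2,\dots\}$ and $m\geq 3$. Then \[ \sigma'_m(n) =\frac{1}{(n-1)!} \sum_{k=1}^\infty (-1)^{k-1} (k-1)!\cdot B_{n,k} \big(1!\cdot p'_{m}(1),\, 2!\cdot p'_m(2),\, \dots,\, (n-k+1)!\cdot p'_m(n-k+1)\big). \]
   Context: The partial exponential Bell polynomial is $B_{n,k}(x_1,\dots,x_{n-k+1})=\sum \frac{n!}{j_1!\cdots j_{n-k+1}!}\prod_{i}\big(\frac{x_i}{i!}\big)^{j_i}$, summed over nonnegative integers $j_1,\dots,j_{n-k+1}$ with $\sum_i j_i=k$ and $\sum_i i\,j_i=n$; $B_{n,k}:=0$ for $k>n$. $\sigma'_m(n)$ is the sum of the positive divisors $d$ of $n$ with $d\equiv0,1$ or $m-1\pmod m$. $p'_m(n)$ is the number of partitions of $n$ in which every part is congruent to $0$, $1$ or $m-1$ modulo $m$. -}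

module Defs where

open import Data.Nat as ℕ using (ℕ; zero; suc; _+_; _*_; _∸_; _!; _≤_; _<?_; NonZero)
open import Data.Nat.Properties using (_!≢0; m*n≢0; _≟_)
open import Data.Nat.Divisibility using (_∣_; _∣?_)
open import Data.Integer using (ℤ; +_; -[1+_])
open import Data.Rational as ℚ using (ℚ; 0ℚ; 1ℚ; _/_)
open import Data.Fin using (Fin; toℕ)
open import Data.Vec using (Vec; []; _∷_)
open import Data.List as List using (List; []; _∷_; filter; length; map; upTo; concatMap; foldr)
open import Data.Product using (_×_)
open import Data.Nat.ListAction using (sum)
open import Data.Sum using (_⊎_)
open import Relation.Nullary using (Dec; yes; no)
open import Relation.Nullary.Decidable using (_×-dec_; _⊎-dec_; ¬?)
open import Relation.Binary.PropositionalEquality using (_≡_)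

sumℚ : List ℚ → ℚ
sumℚ = foldr ℚ._+_ 0ℚ

_^ℚ_ : ℚ → ℕ → ℚ
p ^ℚ zero  = 1ℚ
p ^ℚ suc e = p ℚ.* (p ^ℚ e)

range : ℕ → ℕ → List ℕ
range a len = map (λ i → a + i) (upTo len)

-- Exponent vectors (j_1, ..., j_L), encoded as Vec ℕ L; position
-- p : Fin L stands for the index i = toℕ p + 1.

vecs : (L b : ℕ) → List (Vec ℕ L)
vecs zero    b = [] ∷ []
vecs (suc L) b = concatMap (λ j → map (j ∷_) (vecs L b)) (upTo (suc b))

vsum : ∀ {L} → Vec ℕ L → ℕ
vsum []       = 0
vsum (j ∷ js) = j + vsum js

wsum′ : ∀ {L} → ℕ → Vec ℕ L → ℕ
wsum′ s []       = 0
wsum′ s (j ∷ js) = s * j + wsum′ (suc s) js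

wsum : ∀ {L} → Vec ℕ L → ℕ
wsum = wsum′ 1

factProd : ∀ {L} → Vec ℕ L → ℕ
factProd []       = 1
factProd (j ∷ js) = j ! * factProd js

factProd≢0 : ∀ {L} (js : Vec ℕ L) → NonZero (factProd js)
factProd≢0 []       = _
factProd≢0 (j ∷ js) = m*n≢0 (j !) (factProd js) {{j !≢0}} {{factProd≢0 js}}

monomial′ : ∀ {L} → (ℕ → ℚ) → ℕ → Vec ℕ L → ℚ
monomial′ x s []       = 1ℚ
monomial′ x s (j ∷ js) =
  ((x s ℚ.* ((+ 1 / s !) {{s !≢0}})) ^ℚ j) ℚ.* monomial′ x (suc s) js

-- Partial exponential Bell polynomial B_{n,k}(x_1, ..., x_{n-k+1}),
-- the variables given as a function x : ℕ → ℚ (only x 1 … x (n-k+1) used).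
-- B_{n,k} := 0 for k > n.

bellTerm : ∀ {L} → ℕ → (ℕ → ℚ) → Vec ℕ L → ℚ
bellTerm n x js =
  ((+ (n !) / factProd js) {{factProd≢0 js}}) ℚ.* monomial′ x 1 js

bellB : ℕ → ℕ → (ℕ → ℚ) → ℚ
bellB n k x with n <? k
... | yes _ = 0ℚ
... | no  _ =
  sumℚ (map (bellTerm n x)
    (filter (λ js → (vsum js ≟ k) ×-dec (wsum js ≟ n)) (vecs (n ∸ k + 1) k)))

-- Residue condition: d ≡ 0, 1 or m-1 (mod m), for d ≥ 1, written via
-- divisibility: m ∣ d, m ∣ d - 1, m ∣ d + 1.

Good : ℕ → ℕ → Set
Good m d = (m ∣ d) ⊎ ((m ∣ d ∸ 1) ⊎ (m ∣ suc d))

good? : ∀ m d → Dec (Good m d)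
good? m d = (m ∣? d) ⊎-dec ((m ∣? (d ∸ 1)) ⊎-dec (m ∣? suc d))

sigma′ : ℕ → ℕ → ℕ
sigma′ m n =
  sum (filter (λ d → (d ∣? n) ×-dec good? m d) (range 1 n))

-- Partitions of n as multiplicity vectors (j_1, ..., j_n) with
-- Σ i j_i = n (j_i = multiplicity of part i).  p'_m(n) counts those in
-- which every part i that occurs (j_i ≠ 0) is ≡ 0, 1, m-1 (mod m).

AllowedParts : ℕ → ∀ {L} → ℕ → Vec ℕ L → Set
AllowedParts m s []       = Data.Unit.⊤ where import Data.Unit
AllowedParts m s (j ∷ js) = ((j ≡ 0) ⊎ Good m s) × AllowedParts m (suc s) js

allowed? : ∀ m {L} s (js : Vec ℕ L) → Dec (AllowedParts m s js)
allowed? m s []       = yes _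
allowed? m s (j ∷ js) = ((j ≟ 0) ⊎-dec good? m s) ×-dec allowed? m (suc s) js

partitionCount′ : ℕ → ℕ → ℕ
partitionCount′ m n =
  length (filter (λ js → (wsum js ≟ n) ×-dec allowed? m 1 js) (vecs n n))

-- Right-hand side of Corollary 5 (before the factor 1/(n-1)!):
-- Σ_{k=1}^{n} (-1)^{k-1} (k-1)! B_{n,k}(1!·p'_m(1), …, (n-k+1)!·p'_m(n-k+1))
-- (terms with k > n vanish since B_{n,k} = 0).

signℚ : ℕ → ℚ
signℚ zero          = 1ℚ
signℚ (suc zero)    = ℚ.-_ 1ℚ
signℚ (suc (suc e)) = signℚ e

bellArgs : ℕ → ℕ → ℚ
bellArgs m i = + (i ! * partitionCount′ m i) / 1

rhsSum : ℕ → ℕ → ℚ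
rhsSum m n =
  sumℚ (map (λ k → signℚ (k ∸ 1) ℚ.* ((+ ((k ∸ 1) !) / 1) ℚ.* bellB n k (bellArgs m)))
            (range 1 n))

-- Let a(n) = p′_m(n) and θ = x d/dx.  The generating function P = Σ a(n) xⁿ is the product of
-- 1/(1 - x^d) over the allowed part sizes d, and each factor has θ-logarithmic derivative
-- d x^d/(1 - x^d); summing these gives θP = S P with S = Σ σ′_m(n) xⁿ.  Writing P = 1 + A,
-- the series D = Σ_k (-A)^k θA also satisfies D P = θP, and P is invertible, so S = D.
-- Finally θ(A^(k+1)) = (k+1) A^k θA, and by the multinomial theorem the coefficient of xⁿ in
-- A^k is k!/n! · B_{n,k}(1! a(1), 2! a(2), …); comparing coefficients of xⁿ gives the formula.

module Submission where

open import Defs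
open import Data.Nat as ℕ using (ℕ; zero; suc; _≤_; _<_; z≤n; s≤s; _∸_; _!; _<?_; NonZero)
import Data.Nat.Properties as ℕP
open import Data.Nat.Properties using (_!≢0)
open import Data.Nat.Combinatorics using (_C_; nCk≡n!/k![n-k]!; k![n∸k]!∣n!)
open import Data.Nat.Coprimality using (1-coprimeTo)
import Data.Nat.Coprimality as Coprime
open import Data.Nat.Divisibility using (_∣?_; divides; ∣m+n∣m⇒∣n; ∣m∣n⇒∣m+n; ∣-refl; ∣⇒≤)
open import Data.Nat.DivMod using (m/n*n≡m)
open import Data.Nat.Induction using (<-rec)
open import Data.Nat.ListAction using (sum)
open import Data.Integer as ℤ using ()
import Data.Integer.Properties as ℤP
open import Data.Rational as ℚ using (ℚ; mkℚ; _/_; 0ℚ; 1ℚ; _+_; _*_; -_; _-_; fromℚᵘ; toℚᵘ)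
import Data.Rational.Properties as ℚP
open import Data.Rational.Solver using (module +-*-Solver)
open import Data.Rational.Unnormalised as ℚᵘ using (mkℚᵘ; *≡*)
import Data.Rational.Unnormalised.Properties as ℚᵘP
open import Data.Bool using (if_then_else_)
open import Data.Empty using (⊥-elim)
open import Data.Fin as Fin using (Fin; toℕ)
open import Data.List using (List; []; _∷_; _++_; map; filter; length; concatMap; applyUpTo; upTo)
import Data.List.Properties as Listₚ
open import Data.Vec using (Vec; []; _∷_)
import Data.Vec.Functional as Vector
open import Data.Product using (∃; _,_)
open import Data.Sum using (_⊎_; inj₁; inj₂)
open import Relation.Nullary using (Dec; yes; no; does; ¬_)
open import Relation.Nullary.Decidable using (_×-dec_; _⊎-dec_)
open import Relation.Unary using (Pred; Decidable)
open import Relation.Binary.PropositionalEquality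
open import Algebra.Bundles using (CommutativeRing)
import Algebra.Definitions.RawMonoid as RawMonoid
import Algebra.Properties.CommutativeSemiring.Binomial as Binomial
open import Algebra.Properties.Group ℚP.+-0-group using ()
  renaming (∙-cancelˡ to +-cancelˡ; x∙y⁻¹≈ε⇒x≈y to p-q≡0⇒p≡q)
open ≡-Reasoning

ι : ℕ → ℚ
ι n = ℤ.+ n / 1

ι-mkℚ : ∀ n → ι n ≡ mkℚ (ℤ.+ n) 0 (Coprime.sym (1-coprimeTo n))
ι-mkℚ n = ℚP.normalize-coprime (Coprime.sym (1-coprimeTo n))

ι-+ : ∀ a b → ι (a ℕ.+ b) ≡ ι a + ι b
ι-+ a b rewrite ι-mkℚ a | ι-mkℚ b =
  cong (_/ 1) (sym (cong₂ ℤ._+_ (ℤP.*-identityʳ (ℤ.+ a)) (ℤP.*-identityʳ (ℤ.+ b))))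

ι-* : ∀ a b → ι (a ℕ.* b) ≡ ι a * ι b
ι-* a b rewrite ι-mkℚ a | ι-mkℚ b = cong (_/ 1) (ℤP.pos-* a b)

ι-sum : ∀ xs → ι (sum xs) ≡ sumℚ (map ι xs)
ι-sum []       = refl
ι-sum (x ∷ xs) = trans (ι-+ x (sum xs)) (cong (ι x +_) (ι-sum xs))

1/ι : (d : ℕ) → .{{NonZero d}} → ℚ
1/ι d = ℤ.+ 1 / d

fromℚᵘ-* : ∀ x y → fromℚᵘ (x ℚᵘ.* y) ≡ fromℚᵘ x * fromℚᵘ y
fromℚᵘ-* x y = begin
  fromℚᵘ (x ℚᵘ.* y)
    ≡⟨ ℚP.fromℚᵘ-cong (ℚᵘP.*-cong (ℚᵘP.≃-sym (ℚP.toℚᵘ-fromℚᵘ x)) (ℚᵘP.≃-sym (ℚP.toℚᵘ-fromℚᵘ y))) ⟩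
  fromℚᵘ (toℚᵘ (fromℚᵘ x) ℚᵘ.* toℚᵘ (fromℚᵘ y))
    ≡⟨ ℚP.fromℚᵘ-cong (ℚᵘP.≃-sym (ℚP.toℚᵘ-homo-* (fromℚᵘ x) (fromℚᵘ y))) ⟩
  fromℚᵘ (toℚᵘ (fromℚᵘ x * fromℚᵘ y))
    ≡⟨ ℚP.fromℚᵘ-toℚᵘ _ ⟩
  fromℚᵘ x * fromℚᵘ y ∎

/-ι : ∀ n d .{{_ : NonZero d}} → ℤ.+ n / d ≡ ι n * 1/ι d
/-ι n (suc d) =
  trans (ℚP.fromℚᵘ-cong {mkℚᵘ (ℤ.+ n) d} {mkℚᵘ (ℤ.+ n) 0 ℚᵘ.* mkℚᵘ (ℤ.+ 1) d} (*≡* eq))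
        (fromℚᵘ-* (mkℚᵘ (ℤ.+ n) 0) (mkℚᵘ (ℤ.+ 1) d))
  where
  eq : ℤ.+ n ℤ.* ℤ.+ suc (d ℕ.+ 0) ≡ (ℤ.+ n ℤ.* ℤ.+ 1) ℤ.* ℤ.+ suc d
  eq rewrite ℕP.+-identityʳ d = cong (ℤ._* ℤ.+ suc d) (sym (ℤP.*-identityʳ (ℤ.+ n)))

ι*1/ι : ∀ d .{{_ : NonZero d}} → ι d * 1/ι d ≡ 1ℚ
ι*1/ι (suc d) = trans (sym (/-ι (suc d) (suc d)))
  (ℚP.fromℚᵘ-cong {mkℚᵘ (ℤ.+ suc d) d} {mkℚᵘ (ℤ.+ 1) 0} (*≡* (ℤP.*-comm (ℤ.+ suc d) (ℤ.+ 1))))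

1/ι-* : ∀ c d .{{_ : NonZero c}} .{{_ : NonZero d}} →
        1/ι (c ℕ.* d) {{ℕP.m*n≢0 c d}} ≡ 1/ι c * 1/ι d
1/ι-* (suc c) (suc d) =
  trans (ℚP.fromℚᵘ-cong {mkℚᵘ (ℤ.+ 1) (d ℕ.+ c ℕ.* suc d)} {mkℚᵘ (ℤ.+ 1) c ℚᵘ.* mkℚᵘ (ℤ.+ 1) d} (*≡* refl))
        (fromℚᵘ-* (mkℚᵘ (ℤ.+ 1) c) (mkℚᵘ (ℤ.+ 1) d))

1/[_]! : ℕ → ℚ
1/[ n ]! = 1/ι (n !) {{n !≢0}}

1/ι*ι* : ∀ c .{{_ : NonZero c}} x → 1/ι c * (ι c * x) ≡ x
1/ι*ι* c x = begin
  1/ι c * (ι c * x)    ≡⟨ sym (ℚP.*-assoc (1/ι c) (ι c) x) ⟩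
  (1/ι c * ι c) * x    ≡⟨ cong (_* x) (trans (ℚP.*-comm (1/ι c) (ι c)) (ι*1/ι c)) ⟩
  1ℚ * x               ≡⟨ ℚP.*-identityˡ x ⟩
  x                    ∎

ι-cancelˡ : ∀ c .{{_ : NonZero c}} {x y} → ι c * x ≡ ι c * y → x ≡ y
ι-cancelˡ c {x} {y} eq = begin
  x                      ≡⟨ sym (1/ι*ι* c x) ⟩
  1/ι c * (ι c * x)      ≡⟨ cong (1/ι c *_) eq ⟩
  1/ι c * (ι c * y)      ≡⟨ 1/ι*ι* c y ⟩
  y                      ∎

-- Finite sums

∑< : ℕ → (ℕ → ℚ) → ℚ
∑< zero    f = 0ℚ
∑< (suc n) f = f 0 + ∑< n (λ i → f (suc i))

syntax ∑< n (λ i → e) = ∑[ i < n ] e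

∑-cong : ∀ n {f g : ℕ → ℚ} → (∀ i → i < n → f i ≡ g i) → ∑< n f ≡ ∑< n g
∑-cong zero    eq = refl
∑-cong (suc n) eq = cong₂ _+_ (eq 0 (s≤s z≤n)) (∑-cong n (λ i i<n → eq (suc i) (s≤s i<n)))

∑-zero : ∀ n {f : ℕ → ℚ} → (∀ i → i < n → f i ≡ 0ℚ) → ∑< n f ≡ 0ℚ
∑-zero n eq = trans (∑-cong n eq) (zeros n)
  where
  zeros : ∀ n → ∑[ i < n ] 0ℚ ≡ 0ℚ
  zeros zero    = refl
  zeros (suc n) = cong (0ℚ +_) (zeros n)

∑-+ : ∀ n (f g : ℕ → ℚ) → ∑[ i < n ] (f i + g i) ≡ ∑< n f + ∑< n g
∑-+ zero    f g = refl
∑-+ (suc n) f g rewrite ∑-+ n (λ i → f (suc i)) (λ i → g (suc i)) =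
  solve 4 (λ a b c d → (a :+ b) :+ (c :+ d) := (a :+ c) :+ (b :+ d)) refl
    (f 0) (g 0) (∑< n (λ i → f (suc i))) (∑< n (λ i → g (suc i)))
  where open +-*-Solver

∑-*ˡ : ∀ n c (f : ℕ → ℚ) → ∑[ i < n ] (c * f i) ≡ c * ∑< n f
∑-*ˡ zero    c f = sym (ℚP.*-zeroʳ c)
∑-*ˡ (suc n) c f rewrite ∑-*ˡ n c (λ i → f (suc i)) = sym (ℚP.*-distribˡ-+ c (f 0) _)

∑-split : ∀ n r (f : ℕ → ℚ) → ∑< (n ℕ.+ r) f ≡ ∑< n f + ∑[ i < r ] f (n ℕ.+ i)
∑-split zero    r f = sym (ℚP.+-identityˡ _)
∑-split (suc n) r f rewrite ∑-split n r (λ i → f (suc i)) = sym (ℚP.+-assoc (f 0) _ _)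

∑-vanishing-tail : ∀ n N (f : ℕ → ℚ) → n ≤ N → (∀ i → n ≤ i → f i ≡ 0ℚ) → ∑< N f ≡ ∑< n f
∑-vanishing-tail n N f n≤N vanish with ℕP.m≤n⇒∃[o]m+o≡n n≤N
... | r , refl = begin
  ∑< (n ℕ.+ r) f                              ≡⟨ ∑-split n r f ⟩
  ∑< n f + ∑[ i < r ] f (n ℕ.+ i)             ≡⟨ cong (∑< n f +_) (∑-zero r (λ i _ → vanish (n ℕ.+ i) (ℕP.m≤m+n n i))) ⟩
  ∑< n f + 0ℚ                                 ≡⟨ ℚP.+-identityʳ _ ⟩
  ∑< n f                                      ∎

∑-last : ∀ n (f : ℕ → ℚ) → ∑< (suc n) f ≡ ∑< n f + f n
∑-last zero    f = trans (ℚP.+-identityʳ (f 0)) (sym (ℚP.+-identityˡ (f 0)))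
∑-last (suc n) f rewrite ∑-last n (λ i → f (suc i)) = sym (ℚP.+-assoc (f 0) _ _)

𝟙 : ∀ {p} {P : Set p} → Dec P → ℚ
𝟙 d = if does d then 1ℚ else 0ℚ

𝟙-yes : ∀ {p} {P : Set p} (d : Dec P) → P → 𝟙 d ≡ 1ℚ
𝟙-yes (yes _) _  = refl
𝟙-yes (no ¬p) p = ⊥-elim (¬p p)

𝟙-no : ∀ {p} {P : Set p} (d : Dec P) → ¬ P → 𝟙 d ≡ 0ℚ
𝟙-no (yes p) ¬p = ⊥-elim (¬p p)
𝟙-no (no _)  _  = refl

𝟙-× : ∀ {p q} {P : Set p} {Q : Set q} (a : Dec P) (b : Dec Q) → 𝟙 (a ×-dec b) ≡ 𝟙 a * 𝟙 b
𝟙-× (yes _) (yes _) = refl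
𝟙-× (yes _) (no _)  = refl
𝟙-× (no _)  b       = sym (ℚP.*-zeroˡ (𝟙 b))

𝟙-⇔ : ∀ {p q} {P : Set p} {Q : Set q} (a : Dec P) (b : Dec Q) → (P → Q) → (Q → P) → 𝟙 a ≡ 𝟙 b
𝟙-⇔ (yes p) b P→Q Q→P = sym (𝟙-yes b (P→Q p))
𝟙-⇔ (no ¬p) b P→Q Q→P = sym (𝟙-no b (λ q → ¬p (Q→P q)))

sumℚ-++ : ∀ xs ys → sumℚ (xs ++ ys) ≡ sumℚ xs + sumℚ ys
sumℚ-++ []       ys = sym (ℚP.+-identityˡ _)
sumℚ-++ (x ∷ xs) ys rewrite sumℚ-++ xs ys = sym (ℚP.+-assoc x _ _)

module _ {A : Set} where

  sumℚ-cong : ∀ {f g : A → ℚ} → (∀ x → f x ≡ g x) → ∀ xs → sumℚ (map f xs) ≡ sumℚ (map g xs)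
  sumℚ-cong eq []       = refl
  sumℚ-cong eq (x ∷ xs) = cong₂ _+_ (eq x) (sumℚ-cong eq xs)

  sumℚ-*ˡ : ∀ c (f : A → ℚ) xs → sumℚ (map (λ x → c * f x) xs) ≡ c * sumℚ (map f xs)
  sumℚ-*ˡ c f []       = sym (ℚP.*-zeroʳ c)
  sumℚ-*ˡ c f (x ∷ xs) rewrite sumℚ-*ˡ c f xs = sym (ℚP.*-distribˡ-+ c _ _)

  sumℚ-zero : ∀ {f : A → ℚ} → (∀ x → f x ≡ 0ℚ) → ∀ xs → sumℚ (map f xs) ≡ 0ℚ
  sumℚ-zero z []       = refl
  sumℚ-zero z (x ∷ xs) rewrite z x | sumℚ-zero z xs = refl

  sumℚ-filter : ∀ {ℓ} {P : Pred A ℓ} (P? : Decidable P) (f : A → ℚ) xs →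
                sumℚ (map f (filter P? xs)) ≡ sumℚ (map (λ x → 𝟙 (P? x) * f x) xs)
  sumℚ-filter P? f []       = refl
  sumℚ-filter P? f (x ∷ xs) with P? x
  ... | yes _ = cong₂ _+_ (sym (ℚP.*-identityˡ (f x))) (sumℚ-filter P? f xs)
  ... | no _  = begin
    sumℚ (map f (filter P? xs))                      ≡⟨ sumℚ-filter P? f xs ⟩
    sumℚ (map (λ x → 𝟙 (P? x) * f x) xs)             ≡⟨ ℚP.+-identityˡ _ ⟨
    0ℚ + sumℚ (map (λ x → 𝟙 (P? x) * f x) xs)        ≡⟨ cong (_+ _) (ℚP.*-zeroˡ (f x)) ⟨
    0ℚ * f x + sumℚ (map (λ x → 𝟙 (P? x) * f x) xs)  ∎

  ι-length-filter : ∀ {ℓ} {P : Pred A ℓ} (P? : Decidable P) xs →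
                    ι (length (filter P? xs)) ≡ sumℚ (map (λ x → 𝟙 (P? x)) xs)
  ι-length-filter P? []       = refl
  ι-length-filter P? (x ∷ xs) with P? x
  ... | yes _ = trans (ι-+ 1 (length (filter P? xs))) (cong (1ℚ +_) (ι-length-filter P? xs))
  ... | no _  = trans (ι-length-filter P? xs) (sym (ℚP.+-identityˡ _))

  sumℚ-concatMap : ∀ {B : Set} (f : B → ℚ) (g : A → List B) xs →
                   sumℚ (map f (concatMap g xs)) ≡ sumℚ (map (λ x → sumℚ (map f (g x))) xs)
  sumℚ-concatMap f g []       = refl
  sumℚ-concatMap f g (x ∷ xs) = begin
    sumℚ (map f (g x ++ concatMap g xs))                ≡⟨ cong sumℚ (Listₚ.map-++ f (g x) _) ⟩
    sumℚ (map f (g x) ++ map f (concatMap g xs))        ≡⟨ sumℚ-++ (map f (g x)) _ ⟩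
    sumℚ (map f (g x)) + sumℚ (map f (concatMap g xs))  ≡⟨ cong (sumℚ (map f (g x)) +_) (sumℚ-concatMap f g xs) ⟩
    _                                                   ∎

sumℚ-applyUpTo : ∀ (f : ℕ → ℚ) (g : ℕ → ℕ) n → sumℚ (map f (applyUpTo g n)) ≡ ∑[ i < n ] f (g i)
sumℚ-applyUpTo f g zero    = refl
sumℚ-applyUpTo f g (suc n) = cong (f (g 0) +_) (sumℚ-applyUpTo f (λ i → g (suc i)) n)

sumℚ-upTo : ∀ (f : ℕ → ℚ) n → sumℚ (map f (upTo n)) ≡ ∑< n f
sumℚ-upTo f = sumℚ-applyUpTo f (λ i → i)

sumℚ-range : ∀ (f : ℕ → ℚ) a n → sumℚ (map f (range a n)) ≡ ∑[ i < n ] f (a ℕ.+ i)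
sumℚ-range f a n = trans (cong sumℚ (sym (Listₚ.map-∘ (upTo n)))) (sumℚ-upTo (λ i → f (a ℕ.+ i)) n)

-- Power series, as coefficient sequences

Series : Set
Series = ℕ → ℚ

infix  4 _≈_
infixl 6 _⊕_
infixl 7 _⊛_

_≈_ : Series → Series → Set
f ≈ g = ∀ t → f t ≡ g t

_⊕_ : Series → Series → Series
(f ⊕ g) t = f t + g t

⊝_ : Series → Series
(⊝ f) t = - f t

0ₛ 1ₛ : Series
0ₛ _       = 0ℚ
1ₛ zero    = 1ℚ
1ₛ (suc _) = 0ℚ

tail : Series → Series
tail f i = f (suc i)

-- Cauchy product Σ_{i+j=n} f_i g_j, splitting off the term i = 0
_⊛_ : Series → Series → Series
(f ⊛ g) zero    = f 0 * g 0
(f ⊛ g) (suc n) = f 0 * g (suc n) + (tail f ⊛ g) n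

⊛-cong≤ : ∀ n {f f′ g g′ : Series} → (∀ i → i ≤ n → f i ≡ f′ i) → (∀ i → i ≤ n → g i ≡ g′ i) →
          (f ⊛ g) n ≡ (f′ ⊛ g′) n
⊛-cong≤ zero    ef eg = cong₂ _*_ (ef 0 z≤n) (eg 0 z≤n)
⊛-cong≤ (suc n) ef eg = cong₂ _+_ (cong₂ _*_ (ef 0 z≤n) (eg (suc n) ℕP.≤-refl))
  (⊛-cong≤ n (λ i i≤n → ef (suc i) (s≤s i≤n)) (λ i i≤n → eg i (ℕP.m≤n⇒m≤1+n i≤n)))

⊛-congʳ≤ : ∀ n (f : Series) {g g′ : Series} → (∀ i → i ≤ n → g i ≡ g′ i) → (f ⊛ g) n ≡ (f ⊛ g′) n
⊛-congʳ≤ n f = ⊛-cong≤ n (λ _ _ → refl)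

⊛-congˡ≤ : ∀ n {f f′ : Series} (g : Series) → (∀ i → i ≤ n → f i ≡ f′ i) → (f ⊛ g) n ≡ (f′ ⊛ g) n
⊛-congˡ≤ n g ef = ⊛-cong≤ n ef (λ _ _ → refl)

⊛-snoc : ∀ (f g : Series) n → (f ⊛ g) (suc n) ≡ (f ⊛ tail g) n + f (suc n) * g 0
⊛-snoc f g zero    = refl
⊛-snoc f g (suc n) rewrite ⊛-snoc (tail f) g n =
  sym (ℚP.+-assoc (f 0 * g (suc (suc n))) ((tail f ⊛ tail g) n) (f (suc (suc n)) * g 0))

⊛-comm : ∀ f g → f ⊛ g ≈ g ⊛ f
⊛-comm f g zero    = ℚP.*-comm (f 0) (g 0)
⊛-comm f g (suc n) rewrite ⊛-comm (tail f) g n | ⊛-snoc g f n =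
  trans (ℚP.+-comm (f 0 * g (suc n)) _) (cong ((g ⊛ tail f) n +_) (ℚP.*-comm (f 0) (g (suc n))))

⊛-distribʳ : ∀ h f g → (f ⊕ g) ⊛ h ≈ f ⊛ h ⊕ g ⊛ h
⊛-distribʳ h f g zero    = ℚP.*-distribʳ-+ (h 0) (f 0) (g 0)
⊛-distribʳ h f g (suc n) rewrite ⊛-distribʳ h (tail f) (tail g) n | ℚP.*-distribʳ-+ (h (suc n)) (f 0) (g 0) =
  solve 4 (λ a b c d → (a :+ b) :+ (c :+ d) := (a :+ c) :+ (b :+ d)) refl
    (f 0 * h (suc n)) (g 0 * h (suc n)) ((tail f ⊛ h) n) ((tail g ⊛ h) n)
  where open +-*-Solver

⊛-scaleˡ : ∀ c (f g : Series) → (λ i → c * f i) ⊛ g ≈ (λ n → c * (f ⊛ g) n)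
⊛-scaleˡ c f g zero    = ℚP.*-assoc c (f 0) (g 0)
⊛-scaleˡ c f g (suc n) rewrite ⊛-scaleˡ c (tail f) g n | ℚP.*-assoc c (f 0) (g (suc n)) =
  sym (ℚP.*-distribˡ-+ c _ _)

⊛-zeroˡ : ∀ {f} (g : Series) → f ≈ 0ₛ → f ⊛ g ≈ 0ₛ
⊛-zeroˡ g f≈0 zero    rewrite f≈0 0 = ℚP.*-zeroˡ (g 0)
⊛-zeroˡ g f≈0 (suc n) rewrite f≈0 0 | ⊛-zeroˡ g (λ i → f≈0 (suc i)) n =
  cong (_+ 0ℚ) (ℚP.*-zeroˡ (g (suc n)))

⊛-assoc : ∀ f g h → (f ⊛ g) ⊛ h ≈ f ⊛ (g ⊛ h)
⊛-assoc f g h zero    = ℚP.*-assoc (f 0) (g 0) (h 0)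
⊛-assoc f g h (suc n) = begin
  (f ⊛ g) 0 * h (suc n) + ((λ i → f 0 * g (suc i) + (tail f ⊛ g) i) ⊛ h) n
    ≡⟨ cong ((f ⊛ g) 0 * h (suc n) +_) (⊛-distribʳ h _ (tail f ⊛ g) n) ⟩
  (f ⊛ g) 0 * h (suc n) + (((λ i → f 0 * g (suc i)) ⊛ h) n + ((tail f ⊛ g) ⊛ h) n)
    ≡⟨ cong₂ (λ x y → (f ⊛ g) 0 * h (suc n) + (x + y)) (⊛-scaleˡ (f 0) (tail g) h n) (⊛-assoc (tail f) g h n) ⟩
  (f 0 * g 0) * h (suc n) + (f 0 * (tail g ⊛ h) n + (tail f ⊛ (g ⊛ h)) n)
    ≡⟨ solve 5 (λ a b c d r → (a :* b) :* c :+ (a :* d :+ r) := a :* (b :* c :+ d) :+ r) refl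
         (f 0) (g 0) (h (suc n)) ((tail g ⊛ h) n) ((tail f ⊛ (g ⊛ h)) n) ⟩
  f 0 * (g 0 * h (suc n) + (tail g ⊛ h) n) + (tail f ⊛ (g ⊛ h)) n ∎
  where open +-*-Solver

⊛-identityˡ : ∀ g → 1ₛ ⊛ g ≈ g
⊛-identityˡ g zero    = ℚP.*-identityˡ (g 0)
⊛-identityˡ g (suc n) rewrite ⊛-zeroˡ g (λ _ → refl) n =
  trans (ℚP.+-identityʳ _) (ℚP.*-identityˡ (g (suc n)))

⊛-∑ˡ : ∀ K (c : ℕ → ℚ) (F : ℕ → Series) g t →
  ((λ u → ∑[ j < K ] (c j * F j u)) ⊛ g) t ≡ ∑[ j < K ] (c j * (F j ⊛ g) t)
⊛-∑ˡ zero    c F g t = ⊛-zeroˡ g (λ _ → refl) t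
⊛-∑ˡ (suc K) c F g t = begin
  ((λ u → c 0 * F 0 u + ∑[ j < K ] (c (suc j) * F (suc j) u)) ⊛ g) t
    ≡⟨ ⊛-distribʳ g (λ u → c 0 * F 0 u) _ t ⟩
  ((λ u → c 0 * F 0 u) ⊛ g) t + ((λ u → ∑[ j < K ] (c (suc j) * F (suc j) u)) ⊛ g) t
    ≡⟨ cong₂ _+_ (⊛-scaleˡ (c 0) (F 0) g t) (⊛-∑ˡ K (λ j → c (suc j)) (λ j → F (suc j)) g t) ⟩
  c 0 * (F 0 ⊛ g) t + ∑[ j < K ] (c (suc j) * (F (suc j) ⊛ g) t) ∎

seriesRing : CommutativeRing _ _
seriesRing = record
  { Carrier = Series ; _≈_ = _≈_ ; _+_ = _⊕_ ; _*_ = _⊛_ ; -_ = ⊝_ ; 0# = 0ₛ ; 1# = 1ₛ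
  ; isCommutativeRing = record
    { isRing = record
      { +-isAbelianGroup = record
        { isGroup = record
          { isMonoid = record
            { isSemigroup = record
              { isMagma = record
                { isEquivalence = record
                  { refl = λ _ → refl ; sym = λ p t → sym (p t) ; trans = λ p q t → trans (p t) (q t) }
                ; ∙-cong = λ p q t → cong₂ _+_ (p t) (q t) }
              ; assoc = λ f g h t → ℚP.+-assoc (f t) (g t) (h t) }
            ; identity = (λ f t → ℚP.+-identityˡ (f t)) , (λ f t → ℚP.+-identityʳ (f t)) }
          ; inverse = (λ f t → ℚP.+-inverseˡ (f t)) , (λ f t → ℚP.+-inverseʳ (f t))
          ; ⁻¹-cong = λ p t → cong -_ (p t) }
        ; comm = λ f g t → ℚP.+-comm (f t) (g t) }
      ; *-cong = λ p q t → ⊛-cong≤ t (λ i _ → p i) (λ i _ → q i)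
      ; *-assoc = ⊛-assoc
      ; *-identity = ⊛-identityˡ , (λ f t → trans (⊛-comm f 1ₛ t) (⊛-identityˡ f t))
      ; distrib = (λ h f g t → trans (⊛-comm h (f ⊕ g) t)
                     (trans (⊛-distribʳ h f g t) (cong₂ _+_ (⊛-comm f h t) (⊛-comm g h t))))
                , ⊛-distribʳ }
    ; *-comm = ⊛-comm } }

open CommutativeRing seriesRing using (semiring; commutativeSemiring; ring)
  renaming (*-identityʳ to ⊛-identityʳ; distribˡ to ⊛-distribˡ)
open import Algebra.Properties.Semiring.Exp semiring using (_^_)
open import Algebra.Properties.Ring ring using (-‿distribˡ-*)

⊛-−ˡ : ∀ f g h t → ((λ i → f i - g i) ⊛ h) t ≡ (f ⊛ h) t - (g ⊛ h) t
⊛-−ˡ f g h t = trans (⊛-distribʳ h f (⊝ g) t) (cong ((f ⊛ h) t +_) (sym (-‿distribˡ-* g h t)))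

below-or-above : ∀ p t → t < p ⊎ ∃ λ u → t ≡ p ℕ.+ u
below-or-above zero    t       = inj₂ (t , refl)
below-or-above (suc p) zero    = inj₁ (s≤s z≤n)
below-or-above (suc p) (suc t) with below-or-above p t
... | inj₁ t<p      = inj₁ (s≤s t<p)
... | inj₂ (u , eq) = inj₂ (u , cong suc eq)

shift : ℕ → Series → Series
shift zero    f t       = f t
shift (suc p) f zero    = 0ℚ
shift (suc p) f (suc t) = shift p f t

shift-+ : ∀ p f u → shift p f (p ℕ.+ u) ≡ f u
shift-+ zero    f u = refl
shift-+ (suc p) f u = shift-+ p f u

shift-< : ∀ p f t → t < p → shift p f t ≡ 0ℚ
shift-< (suc p) f zero    _         = refl
shift-< (suc p) f (suc t) (s≤s t<p) = shift-< p f t t<p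

shift-≥ : ∀ p f t → p ≤ t → shift p f t ≡ f (t ∸ p)
shift-≥ zero    f t       _         = refl
shift-≥ (suc p) f (suc t) (s≤s p≤t) = shift-≥ p f t p≤t

shift-cong : ∀ p {f g} → f ≈ g → shift p f ≈ shift p g
shift-cong zero    f≈g t       = f≈g t
shift-cong (suc p) f≈g zero    = refl
shift-cong (suc p) f≈g (suc t) = shift-cong p f≈g t

shift-scale : ∀ p c f → shift p (λ u → c * f u) ≈ (λ t → c * shift p f t)
shift-scale zero    c f t       = refl
shift-scale (suc p) c f zero    = sym (ℚP.*-zeroʳ c)
shift-scale (suc p) c f (suc t) = shift-scale p c f t

shift-sumℚ : ∀ {A : Set} p (g : A → Series) t xs →
             sumℚ (map (λ x → shift p (g x) t) xs) ≡ shift p (λ u → sumℚ (map (λ x → g x u) xs)) t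
shift-sumℚ zero    g t       xs = refl
shift-sumℚ (suc p) g zero    xs = sumℚ-zero (λ _ → refl) xs
shift-sumℚ (suc p) g (suc t) xs = shift-sumℚ p g t xs

shift-∑ : ∀ p K (g : ℕ → Series) t → ∑[ j < K ] shift p (g j) t ≡ shift p (λ u → ∑[ j < K ] g j u) t
shift-∑ zero    K g t       = refl
shift-∑ (suc p) K g zero    = ∑-zero K (λ _ _ → refl)
shift-∑ (suc p) K g (suc t) = shift-∑ p K g t

shift-cong< : ∀ p {f g} n → (∀ u → u < n → f u ≡ g u) → ∀ t → t < p ℕ.+ n → shift p f t ≡ shift p g t
shift-cong< zero    n eq t       lt       = eq t lt
shift-cong< (suc p) n eq zero    _        = refl
shift-cong< (suc p) n eq (suc t) (s≤s lt) = shift-cong< p n eq t lt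

monomial : ℕ → ℚ → Series
monomial zero    c zero    = c
monomial zero    c (suc t) = 0ℚ
monomial (suc p) c zero    = 0ℚ
monomial (suc p) c (suc t) = monomial p c t

monomial-zero : ∀ c → monomial 0 c ≈ (λ t → c * 1ₛ t)
monomial-zero c zero    = sym (ℚP.*-identityʳ c)
monomial-zero c (suc t) = sym (ℚP.*-zeroʳ c)

monomial-+ : ∀ p q c → monomial (p ℕ.+ q) c ≈ shift p (monomial q c)
monomial-+ zero    q c t       = refl
monomial-+ (suc p) q c zero    = refl
monomial-+ (suc p) q c (suc t) = monomial-+ p q c t

monomial-scale : ∀ p c d → monomial p (c * d) ≈ (λ t → c * monomial p d t)
monomial-scale zero    c d zero    = refl
monomial-scale zero    c d (suc t) = sym (ℚP.*-zeroʳ c)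
monomial-scale (suc p) c d zero    = sym (ℚP.*-zeroʳ c)
monomial-scale (suc p) c d (suc t) = monomial-scale p c d t

monomial-self : ∀ p c → monomial p c p ≡ c
monomial-self zero    c = refl
monomial-self (suc p) c = monomial-self p c

monomial-other : ∀ p c u → u ≢ p → monomial p c u ≡ 0ℚ
monomial-other zero    c zero    u≢p = ⊥-elim (u≢p refl)
monomial-other zero    c (suc u) u≢p = refl
monomial-other (suc p) c zero    u≢p = refl
monomial-other (suc p) c (suc u) u≢p = monomial-other p c u (λ eq → u≢p (cong suc eq))

⊛-monomialˡ : ∀ p c f → monomial p c ⊛ f ≈ (λ t → c * shift p f t)
⊛-monomialˡ zero    c f t       = begin
  (monomial 0 c ⊛ f) t          ≡⟨ ⊛-congˡ≤ t f (λ i _ → monomial-zero c i) ⟩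
  ((λ i → c * 1ₛ i) ⊛ f) t      ≡⟨ ⊛-scaleˡ c 1ₛ f t ⟩
  c * (1ₛ ⊛ f) t                ≡⟨ cong (c *_) (⊛-identityˡ f t) ⟩
  c * f t                       ∎
⊛-monomialˡ (suc p) c f zero    = trans (ℚP.*-zeroˡ (f 0)) (sym (ℚP.*-zeroʳ c))
⊛-monomialˡ (suc p) c f (suc t) = begin
  0ℚ * f (suc t) + (monomial p c ⊛ f) t  ≡⟨ cong (_+ (monomial p c ⊛ f) t) (ℚP.*-zeroˡ (f (suc t))) ⟩
  0ℚ + (monomial p c ⊛ f) t              ≡⟨ ℚP.+-identityˡ _ ⟩
  (monomial p c ⊛ f) t                   ≡⟨ ⊛-monomialˡ p c f t ⟩
  c * shift p f t                        ∎

⊛-shiftˡ : ∀ p f g → shift p f ⊛ g ≈ shift p (f ⊛ g)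
⊛-shiftˡ p f g t = begin
  (shift p f ⊛ g) t                   ≡⟨ ⊛-congˡ≤ t g (λ u _ → sym (unit f u)) ⟩
  ((monomial p 1ℚ ⊛ f) ⊛ g) t         ≡⟨ ⊛-assoc (monomial p 1ℚ) f g t ⟩
  (monomial p 1ℚ ⊛ (f ⊛ g)) t         ≡⟨ unit (f ⊛ g) t ⟩
  shift p (f ⊛ g) t                   ∎
  where
  unit : ∀ h → monomial p 1ℚ ⊛ h ≈ shift p h
  unit h t = trans (⊛-monomialˡ p 1ℚ h t) (ℚP.*-identityˡ _)

monomial-^ : ∀ s c j → monomial s c ^ j ≈ monomial (s ℕ.* j) (c ^ℚ j)
monomial-^ s c zero    t = begin
  1ₛ t                        ≡⟨ sym (ℚP.*-identityˡ (1ₛ t)) ⟩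
  1ℚ * 1ₛ t                   ≡⟨ sym (monomial-zero 1ℚ t) ⟩
  monomial 0 1ℚ t             ≡⟨ cong (λ p → monomial p 1ℚ t) (sym (ℕP.*-zeroʳ s)) ⟩
  monomial (s ℕ.* 0) 1ℚ t     ∎
monomial-^ s c (suc j) t = begin
  (monomial s c ⊛ monomial s c ^ j) t           ≡⟨ ⊛-monomialˡ s c _ t ⟩
  c * shift s (monomial s c ^ j) t              ≡⟨ cong (c *_) (shift-cong s (monomial-^ s c j) t) ⟩
  c * shift s (monomial (s ℕ.* j) (c ^ℚ j)) t   ≡⟨ cong (c *_) (sym (monomial-+ s (s ℕ.* j) (c ^ℚ j) t)) ⟩
  c * monomial (s ℕ.+ s ℕ.* j) (c ^ℚ j) t       ≡⟨ sym (monomial-scale (s ℕ.+ s ℕ.* j) c (c ^ℚ j) t) ⟩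
  monomial (s ℕ.+ s ℕ.* j) (c ^ℚ suc j) t       ≡⟨ cong (λ p → monomial p (c ^ℚ suc j) t) (sym (ℕP.*-suc s j)) ⟩
  monomial (s ℕ.* suc j) (c ^ℚ suc j) t         ∎

𝟙≟-shift : ∀ p w t → 𝟙 (p ℕ.+ w ℕP.≟ t) ≡ shift p (λ u → 𝟙 (w ℕP.≟ u)) t
𝟙≟-shift zero    w t       = refl
𝟙≟-shift (suc p) w zero    = refl
𝟙≟-shift (suc p) w (suc t) = 𝟙≟-shift p w t

x^_∣_ : ℕ → Series → Set
x^ p ∣ f = ∀ t → t < p → f t ≡ 0ℚ

⊛-x^∣ : ∀ p q {f g} → x^ p ∣ f → x^ q ∣ g → x^ (p ℕ.+ q) ∣ (f ⊛ g)
⊛-x^∣ zero    q {f} {g} _ g0 zero    lt = trans (cong (f 0 *_) (g0 0 lt)) (ℚP.*-zeroʳ (f 0))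
⊛-x^∣ zero    q {f} {g} _ g0 (suc t) lt = begin
  f 0 * g (suc t) + (tail f ⊛ g) t  ≡⟨ cong₂ _+_ (trans (cong (f 0 *_) (g0 (suc t) lt)) (ℚP.*-zeroʳ (f 0)))
                                                 (⊛-x^∣ zero q (λ _ ()) g0 t (ℕP.<-trans (ℕP.n<1+n t) lt)) ⟩
  0ℚ + 0ℚ                           ≡⟨ ℚP.+-identityʳ 0ℚ ⟩
  0ℚ                                ∎
⊛-x^∣ (suc p) q {f} {g} f0 _ zero    _         = trans (cong (_* g 0) (f0 0 (s≤s z≤n))) (ℚP.*-zeroˡ (g 0))
⊛-x^∣ (suc p) q {f} {g} f0 g0 (suc t) (s≤s lt) = begin
  f 0 * g (suc t) + (tail f ⊛ g) t  ≡⟨ cong₂ _+_ (trans (cong (_* g (suc t)) (f0 0 (s≤s z≤n))) (ℚP.*-zeroˡ (g (suc t))))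
                                                 (⊛-x^∣ p q (λ u u<p → f0 (suc u) (s≤s u<p)) g0 t lt) ⟩
  0ℚ + 0ℚ                           ≡⟨ ℚP.+-identityʳ 0ℚ ⟩
  0ℚ                                ∎

^-x^∣ : ∀ {A} → x^ 1 ∣ A → ∀ k → x^ k ∣ (A ^ k)
^-x^∣ A0 zero    t ()
^-x^∣ A0 (suc k) = ⊛-x^∣ 1 k A0 (^-x^∣ A0 k)

-- The Euler operator θ = x d/dx

θ : Series → Series
θ f n = ι n * f n

θ-zero : ∀ f → θ f 0 ≡ 0ℚ
θ-zero f = ℚP.*-zeroˡ (f 0)

tail-θ : ∀ f → tail (θ f) ≈ tail f ⊕ θ (tail f)
tail-θ f i = begin
  ι (suc i) * f (suc i)                  ≡⟨ cong (_* f (suc i)) (ι-+ 1 i) ⟩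
  (1ℚ + ι i) * f (suc i)                 ≡⟨ ℚP.*-distribʳ-+ (f (suc i)) 1ℚ (ι i) ⟩
  1ℚ * f (suc i) + ι i * f (suc i)       ≡⟨ cong (_+ ι i * f (suc i)) (ℚP.*-identityˡ (f (suc i))) ⟩
  f (suc i) + ι i * f (suc i)            ∎

θ-⊕ : ∀ f g → θ (f ⊕ g) ≈ θ f ⊕ θ g
θ-⊕ f g t = ℚP.*-distribˡ-+ (ι t) (f t) (g t)

θ-⊛ : ∀ f g → θ (f ⊛ g) ≈ θ f ⊛ g ⊕ f ⊛ θ g
θ-⊛ f g zero    = trans (θ-zero (f ⊛ g)) (sym (begin
  θ f 0 * g 0 + f 0 * θ g 0  ≡⟨ cong₂ (λ a b → a * g 0 + f 0 * b) (θ-zero f) (θ-zero g) ⟩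
  0ℚ * g 0 + f 0 * 0ℚ        ≡⟨ cong₂ _+_ (ℚP.*-zeroˡ (g 0)) (ℚP.*-zeroʳ (f 0)) ⟩
  0ℚ                         ∎))
θ-⊛ f g (suc n) = begin
  ι (suc n) * (f 0 * g (suc n) + y)
    ≡⟨ solve 4 (λ N a b y → N :* (a :* b :+ y) := a :* (N :* b) :+ N :* y) refl (ι (suc n)) (f 0) (g (suc n)) y ⟩
  f 0 * θ g (suc n) + ι (suc n) * y
    ≡⟨ cong (λ N → f 0 * θ g (suc n) + N * y) (ι-+ 1 n) ⟩
  f 0 * θ g (suc n) + (1ℚ + ι n) * y
    ≡⟨ cong (f 0 * θ g (suc n) +_) (solve 2 (λ N y → (con 1ℚ :+ N) :* y := y :+ N :* y) refl (ι n) y) ⟩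
  f 0 * θ g (suc n) + (y + θ (tail f ⊛ g) n)
    ≡⟨ cong (λ z → f 0 * θ g (suc n) + (y + z)) (θ-⊛ (tail f) g n) ⟩
  f 0 * θ g (suc n) + (y + ((θ (tail f) ⊛ g) n + (tail f ⊛ θ g) n))
    ≡⟨ solve 4 (λ a b c d → a :+ (b :+ (c :+ d)) := (b :+ c) :+ (a :+ d)) refl
         (f 0 * θ g (suc n)) y ((θ (tail f) ⊛ g) n) ((tail f ⊛ θ g) n) ⟩
  (y + (θ (tail f) ⊛ g) n) + (f ⊛ θ g) (suc n)
    ≡⟨ cong (_+ (f ⊛ θ g) (suc n)) (sym (⊛-distribʳ g (tail f) (θ (tail f)) n)) ⟩
  ((tail f ⊕ θ (tail f)) ⊛ g) n + (f ⊛ θ g) (suc n)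
    ≡⟨ cong (_+ (f ⊛ θ g) (suc n)) (⊛-congˡ≤ n g (λ i _ → sym (tail-θ f i))) ⟩
  (tail (θ f) ⊛ g) n + (f ⊛ θ g) (suc n)
    ≡⟨ cong (_+ (f ⊛ θ g) (suc n)) (sym (θf⊛g-suc)) ⟩
  (θ f ⊛ g) (suc n) + (f ⊛ θ g) (suc n) ∎
  where
  open +-*-Solver
  y = (tail f ⊛ g) n
  θf⊛g-suc : (θ f ⊛ g) (suc n) ≡ (tail (θ f) ⊛ g) n
  θf⊛g-suc = begin
    θ f 0 * g (suc n) + (tail (θ f) ⊛ g) n  ≡⟨ cong (λ c → c * g (suc n) + (tail (θ f) ⊛ g) n) (θ-zero f) ⟩
    0ℚ * g (suc n) + (tail (θ f) ⊛ g) n     ≡⟨ cong (_+ (tail (θ f) ⊛ g) n) (ℚP.*-zeroˡ (g (suc n))) ⟩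
    0ℚ + (tail (θ f) ⊛ g) n                 ≡⟨ ℚP.+-identityˡ ((tail (θ f) ⊛ g) n) ⟩
    (tail (θ f) ⊛ g) n                      ∎

θ-1ₛ : θ 1ₛ ≈ 0ₛ
θ-1ₛ zero    = θ-zero 1ₛ
θ-1ₛ (suc t) = ℚP.*-zeroʳ (ι (suc t))

θ-^ : ∀ A k → θ (A ^ suc k) ≈ (λ n → ι (suc k) * (A ^ k ⊛ θ A) n)
θ-^ A zero    t = begin
  θ (A ⊛ 1ₛ) t                    ≡⟨ θ-⊛ A 1ₛ t ⟩
  (θ A ⊛ 1ₛ) t + (A ⊛ θ 1ₛ) t     ≡⟨ cong₂ _+_ (⊛-identityʳ (θ A) t) (trans (⊛-comm A (θ 1ₛ) t) (⊛-zeroˡ A θ-1ₛ t)) ⟩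
  θ A t + 0ℚ                      ≡⟨ ℚP.+-identityʳ _ ⟩
  θ A t                           ≡⟨ sym (trans (ℚP.*-identityˡ _) (⊛-identityˡ (θ A) t)) ⟩
  ι 1 * (1ₛ ⊛ θ A) t              ∎
θ-^ A (suc k) t = begin
  θ (A ⊛ A ^ suc k) t
    ≡⟨ θ-⊛ A (A ^ suc k) t ⟩
  (θ A ⊛ A ^ suc k) t + (A ⊛ θ (A ^ suc k)) t
    ≡⟨ cong₂ _+_ (trans (⊛-comm (θ A) _ t) (⊛-assoc A (A ^ k) (θ A) t))
                 (trans (⊛-congʳ≤ t A (λ u _ → θ-^ A k u)) (trans (⊛-comm A _ t) (trans (⊛-scaleˡ (ι (suc k)) _ A t)
                   (cong (ι (suc k) *_) (⊛-comm _ A t))))) ⟩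
  W + ι (suc k) * W
    ≡⟨ solve 2 (λ w N → w :+ N :* w := (con 1ℚ :+ N) :* w) refl W (ι (suc k)) ⟩
  (1ℚ + ι (suc k)) * W
    ≡⟨ cong (_* W) (sym (ι-+ 1 (suc k))) ⟩
  ι (suc (suc k)) * W
    ≡⟨ cong (ι (suc (suc k)) *_) (sym (⊛-assoc A (A ^ k) (θ A) t)) ⟩
  ι (suc (suc k)) * (A ^ suc k ⊛ θ A) t ∎
  where
  open +-*-Solver
  W = (A ⊛ (A ^ k ⊛ θ A)) t

θ-shift : ∀ p f → θ (shift p f) ≈ (λ t → ι p * shift p f t) ⊕ shift p (θ f)
θ-shift p f t with below-or-above p t
... | inj₁ t<p = begin
  ι t * shift p f t                              ≡⟨ cong (ι t *_) (shift-< p f t t<p) ⟩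
  ι t * 0ℚ                                       ≡⟨ ℚP.*-zeroʳ (ι t) ⟩
  0ℚ                                             ≡⟨ cong (_+ 0ℚ) (ℚP.*-zeroʳ (ι p)) ⟨
  ι p * 0ℚ + 0ℚ                                  ≡⟨ cong₂ (λ a b → ι p * a + b) (shift-< p f t t<p) (shift-< p (θ f) t t<p) ⟨
  ι p * shift p f t + shift p (θ f) t            ∎
... | inj₂ (u , refl) = begin
  ι (p ℕ.+ u) * shift p f (p ℕ.+ u)              ≡⟨ cong₂ _*_ (ι-+ p u) (shift-+ p f u) ⟩
  (ι p + ι u) * f u                              ≡⟨ ℚP.*-distribʳ-+ (f u) (ι p) (ι u) ⟩
  ι p * f u + ι u * f u                          ≡⟨ sym (cong₂ (λ a b → ι p * a + b) (shift-+ p f u) (shift-+ p (θ f) u)) ⟩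
  ι p * shift p f (p ℕ.+ u) + shift p (θ f) (p ℕ.+ u) ∎

shift-fixpoint-unique : ∀ p {h X Y : Series} →
  X ≈ h ⊕ shift (suc p) X → Y ≈ h ⊕ shift (suc p) Y → X ≈ Y
shift-fixpoint-unique p {h} {X} {Y} X≈ Y≈ = <-rec _ step
  where
  step : ∀ t → (∀ {u} → u < t → X u ≡ Y u) → X t ≡ Y t
  step t rec with below-or-above (suc p) t
  ... | inj₁ t<p = begin
    X t                            ≡⟨ X≈ t ⟩
    h t + shift (suc p) X t        ≡⟨ cong (h t +_) (trans (shift-< (suc p) X t t<p) (sym (shift-< (suc p) Y t t<p))) ⟩
    h t + shift (suc p) Y t        ≡⟨ Y≈ t ⟨
    Y t                            ∎
  ... | inj₂ (u , refl) = begin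
    X (suc p ℕ.+ u)                           ≡⟨ X≈ (suc p ℕ.+ u) ⟩
    h (suc p ℕ.+ u) + shift (suc p) X (suc p ℕ.+ u)  ≡⟨ cong (h (suc p ℕ.+ u) +_) (shift-+ (suc p) X u) ⟩
    h (suc p ℕ.+ u) + X u                     ≡⟨ cong (h (suc p ℕ.+ u) +_) (rec (s≤s (ℕP.m≤n+m u p))) ⟩
    h (suc p ℕ.+ u) + Y u                     ≡⟨ cong (h (suc p ℕ.+ u) +_) (shift-+ (suc p) Y u) ⟨
    h (suc p ℕ.+ u) + shift (suc p) Y (suc p ℕ.+ u)  ≡⟨ Y≈ (suc p ℕ.+ u) ⟨
    Y (suc p ℕ.+ u)                           ∎

∏ₛ : (ℕ → Series) → ℕ → ℕ → Series
∏ₛ F s zero    = 1ₛ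
∏ₛ F s (suc L) = F s ⊛ ∏ₛ F (suc s) L

∑ₛ : (ℕ → Series) → ℕ → ℕ → Series
∑ₛ F s zero    = 0ₛ
∑ₛ F s (suc L) = F s ⊕ ∑ₛ F (suc s) L

∑ₛ-∑ : ∀ F s L t → ∑ₛ F s L t ≡ ∑[ i < L ] F (s ℕ.+ i) t
∑ₛ-∑ F s zero    t = refl
∑ₛ-∑ F s (suc L) t = cong₂ _+_ (cong (λ i → F i t) (sym (ℕP.+-identityʳ s)))
  (trans (∑ₛ-∑ F (suc s) L t) (∑-cong L (λ i _ → cong (λ j → F j t) (sym (ℕP.+-suc s i)))))

θ-∏ : ∀ {F g : ℕ → Series} → (∀ s → θ (F (suc s)) ≈ g (suc s) ⊛ F (suc s)) →
      ∀ s L → θ (∏ₛ F (suc s) L) ≈ ∑ₛ g (suc s) L ⊛ ∏ₛ F (suc s) L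
θ-∏ {F} {g} θF s zero    t = trans (θ-1ₛ t) (sym (⊛-zeroˡ 1ₛ (λ _ → refl) t))
θ-∏ {F} {g} θF s′ (suc L) t = begin
  θ (F s ⊛ P) t
    ≡⟨ θ-⊛ (F s) P t ⟩
  (θ (F s) ⊛ P) t + (F s ⊛ θ P) t
    ≡⟨ cong₂ _+_ (⊛-congˡ≤ t P (λ u _ → θF s′ u)) (⊛-congʳ≤ t (F s) (λ u _ → θ-∏ θF s L u)) ⟩
  ((g s ⊛ F s) ⊛ P) t + (F s ⊛ (G ⊛ P)) t
    ≡⟨ cong₂ _+_ (⊛-assoc (g s) (F s) P t) (trans (sym (⊛-assoc (F s) G P t))
         (trans (⊛-congˡ≤ t P (λ u _ → ⊛-comm (F s) G u)) (⊛-assoc G (F s) P t))) ⟩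
  (g s ⊛ (F s ⊛ P)) t + (G ⊛ (F s ⊛ P)) t
    ≡⟨ sym (⊛-distribʳ (F s ⊛ P) (g s) G t) ⟩
  ((g s ⊕ G) ⊛ (F s ⊛ P)) t ∎
  where
  s = suc s′
  P = ∏ₛ F (suc s) L
  G = ∑ₛ g (suc s) L

∏ₛ-below : ∀ {F} → (∀ s t → t < s → F s t ≡ 1ₛ t) → ∀ s L t → t < s → ∏ₛ F s L t ≡ 1ₛ t
∏ₛ-below F≡1 s zero    t t<s = refl
∏ₛ-below {F} F≡1 s (suc L) t t<s = begin
  (F s ⊛ ∏ₛ F (suc s) L) t   ≡⟨ ⊛-congˡ≤ t (∏ₛ F (suc s) L) (λ u u≤t → F≡1 s u (ℕP.≤-<-trans u≤t t<s)) ⟩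
  (1ₛ ⊛ ∏ₛ F (suc s) L) t    ≡⟨ ⊛-identityˡ _ t ⟩
  ∏ₛ F (suc s) L t           ≡⟨ ∏ₛ-below F≡1 (suc s) L t (ℕP.m<n⇒m<1+n t<s) ⟩
  1ₛ t                       ∎

∏ₛ-stable : ∀ {F} → (∀ s t → t < s → F s t ≡ 1ₛ t) → ∀ s L r t → t < s ℕ.+ L → ∏ₛ F s (L ℕ.+ r) t ≡ ∏ₛ F s L t
∏ₛ-stable F≡1 s zero    r t lt = ∏ₛ-below F≡1 s r t (subst (t <_) (ℕP.+-identityʳ s) lt)
∏ₛ-stable {F} F≡1 s (suc L) r t lt = ⊛-congʳ≤ t (F s)
  (λ u u≤t → ∏ₛ-stable F≡1 (suc s) L r u (ℕP.≤-<-trans u≤t (subst (t <_) (ℕP.+-suc s L) lt)))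

-- The generating function of partitions into allowed parts

-- 1 / (1 - x^S)
geometric : ℕ → Series
geometric S t = 𝟙 (S ∣? t)

geometric-below : ∀ s t → t < suc s → geometric (suc s) t ≡ 1ₛ t
geometric-below s zero    _  = 𝟙-yes (suc s ∣? 0) (divides 0 refl)
geometric-below s (suc t) lt = 𝟙-no (suc s ∣? suc t) (λ d → ℕP.<⇒≱ lt (∣⇒≤ d))

geometric-+ : ∀ S u → geometric S (S ℕ.+ u) ≡ geometric S u
geometric-+ S u = 𝟙-⇔ (S ∣? (S ℕ.+ u)) (S ∣? u) (λ d → ∣m+n∣m⇒∣n d ∣-refl) (∣m∣n⇒∣m+n ∣-refl)

geometric-unfold : ∀ s → geometric (suc s) ≈ 1ₛ ⊕ shift (suc s) (geometric (suc s))
geometric-unfold s t with below-or-above (suc s) t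
... | inj₁ t<S = begin
  geometric (suc s) t               ≡⟨ geometric-below s t t<S ⟩
  1ₛ t                              ≡⟨ ℚP.+-identityʳ (1ₛ t) ⟨
  1ₛ t + 0ℚ                         ≡⟨ cong (1ₛ t +_) (shift-< (suc s) (geometric (suc s)) t t<S) ⟨
  1ₛ t + shift (suc s) (geometric (suc s)) t ∎
... | inj₂ (u , refl) = begin
  geometric (suc s) (suc s ℕ.+ u)   ≡⟨ geometric-+ (suc s) u ⟩
  geometric (suc s) u               ≡⟨ shift-+ (suc s) (geometric (suc s)) u ⟨
  shift (suc s) (geometric (suc s)) (suc s ℕ.+ u)        ≡⟨ ℚP.+-identityˡ _ ⟨
  0ℚ + shift (suc s) (geometric (suc s)) (suc s ℕ.+ u)   ∎

geometric-partial : ∀ s N t → t < N → ∑[ j < N ] monomial (suc s ℕ.* j) 1ℚ t ≡ geometric (suc s) t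
geometric-partial s (suc N) t t<N = begin
  monomial (S ℕ.* 0) 1ℚ t + ∑[ j < N ] monomial (S ℕ.* suc j) 1ℚ t
    ≡⟨ cong₂ _+_ (trans (cong (λ p → monomial p 1ℚ t) (ℕP.*-zeroʳ S)) (trans (monomial-zero 1ℚ t) (ℚP.*-identityˡ (1ₛ t))))
                 (∑-cong N (λ j _ → trans (cong (λ p → monomial p 1ℚ t) (ℕP.*-suc S j)) (monomial-+ S (S ℕ.* j) 1ℚ t))) ⟩
  1ₛ t + ∑[ j < N ] shift S (monomial (S ℕ.* j) 1ℚ) t
    ≡⟨ cong (1ₛ t +_) (shift-∑ S N (λ j → monomial (S ℕ.* j) 1ℚ) t) ⟩
  1ₛ t + shift S (λ u → ∑[ j < N ] monomial (S ℕ.* j) 1ℚ u) t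
    ≡⟨ cong (1ₛ t +_) (shift-cong< S N (geometric-partial s N) t (s≤s (ℕP.≤-trans (ℕP.≤-pred t<N) (ℕP.m≤n+m N s)))) ⟩
  1ₛ t + shift S (geometric S) t
    ≡⟨ geometric-unfold s t ⟨
  geometric S t ∎
  where S = suc s

factor : ∀ {G : Set} → Dec G → ℕ → Series
factor (yes _) S = geometric S
factor (no _)  S = 1ₛ

factor-below : ∀ {G : Set} (g : Dec G) s t → t < suc s → factor g (suc s) t ≡ 1ₛ t
factor-below (yes _) s t lt = geometric-below s t lt
factor-below (no _)  s t lt = refl

factor-partial : ∀ {G : Set} (g : Dec G) s b t → t ≤ b →
  ∑[ j < suc b ] (𝟙 ((j ℕP.≟ 0) ⊎-dec g) * monomial (suc s ℕ.* j) 1ℚ t) ≡ factor g (suc s) t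
factor-partial (yes G) s b t t≤b = trans (∑-cong (suc b) allowed) (geometric-partial s (suc b) t (s≤s t≤b))
  where
  allowed : ∀ j → j < suc b → 𝟙 ((j ℕP.≟ 0) ⊎-dec yes G) * monomial (suc s ℕ.* j) 1ℚ t ≡ monomial (suc s ℕ.* j) 1ℚ t
  allowed zero    _ = ℚP.*-identityˡ _
  allowed (suc j) _ = ℚP.*-identityˡ _
factor-partial (no ¬G) s b t t≤b = begin
  1ℚ * monomial (suc s ℕ.* 0) 1ℚ t + ∑[ j < b ] (0ℚ * monomial (suc s ℕ.* suc j) 1ℚ t)
    ≡⟨ cong₂ _+_ (trans (ℚP.*-identityˡ _) (cong (λ p → monomial p 1ℚ t) (ℕP.*-zeroʳ (suc s))))
                 (∑-zero b (λ j _ → ℚP.*-zeroˡ (monomial (suc s ℕ.* suc j) 1ℚ t))) ⟩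
  monomial 0 1ℚ t + 0ℚ                ≡⟨ ℚP.+-identityʳ _ ⟩
  monomial 0 1ℚ t                     ≡⟨ trans (monomial-zero 1ℚ t) (ℚP.*-identityˡ (1ₛ t)) ⟩
  1ₛ t                                ∎

θlogFactor : ∀ {G : Set} → Dec G → ℕ → Series
θlogFactor (yes _) S t = ι S * shift S (geometric S) t
θlogFactor (no _)  S   = 0ₛ

θ-factor : ∀ {G : Set} (g : Dec G) s → θ (factor g (suc s)) ≈ θlogFactor g (suc s) ⊛ factor g (suc s)
θ-factor (no _)  s t = trans (θ-1ₛ t) (sym (⊛-zeroˡ 1ₛ (λ _ → refl) t))
-- Since H = 1 + x^S H, both θH and h ⊛ H solve X = h + x^S X.
θ-factor (yes G) s = shift-fixpoint-unique s {h} θH-unfold hH-unfold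
  where
  S = suc s
  H = geometric S
  h = θlogFactor (yes G) S
  θH-unfold : θ H ≈ h ⊕ shift S (θ H)
  θH-unfold t = begin
    ι t * H t                                      ≡⟨ cong (ι t *_) (geometric-unfold s t) ⟩
    θ (1ₛ ⊕ shift S H) t                           ≡⟨ θ-⊕ 1ₛ (shift S H) t ⟩
    θ 1ₛ t + θ (shift S H) t                       ≡⟨ cong₂ _+_ (θ-1ₛ t) (θ-shift S H t) ⟩
    0ℚ + (h t + shift S (θ H) t)                   ≡⟨ ℚP.+-identityˡ _ ⟩
    h t + shift S (θ H) t                          ∎
  hH-unfold : h ⊛ H ≈ h ⊕ shift S (h ⊛ H)
  hH-unfold t = begin
    (h ⊛ H) t                                      ≡⟨ ⊛-congʳ≤ t h (λ u _ → geometric-unfold s u) ⟩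
    (h ⊛ (1ₛ ⊕ shift S H)) t                       ≡⟨ ⊛-distribˡ h 1ₛ (shift S H) t ⟩
    (h ⊛ 1ₛ) t + (h ⊛ shift S H) t                 ≡⟨ cong₂ _+_ (⊛-identityʳ h t) (⊛-comm h (shift S H) t) ⟩
    h t + (shift S H ⊛ h) t                        ≡⟨ cong (h t +_) (⊛-shiftˡ S H h t) ⟩
    h t + shift S (H ⊛ h) t                        ≡⟨ cong (h t +_) (shift-cong S (⊛-comm H h) t) ⟩
    h t + shift S (h ⊛ H) t                        ∎

θlogFactor-suc : ∀ {G : Set} (g : Dec G) s k → θlogFactor g (suc s) (suc k) ≡ 𝟙 ((suc s ∣? suc k) ×-dec g) * ι (suc s)
θlogFactor-suc (yes G) s k = begin
  ι (suc s) * shift (suc s) (geometric (suc s)) (suc k)       ≡⟨ cong (ι (suc s) *_) (sym (trans (geometric-unfold s (suc k)) (ℚP.+-identityˡ (shift (suc s) (geometric (suc s)) (suc k))))) ⟩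
  ι (suc s) * 𝟙 (suc s ∣? suc k)                             ≡⟨ ℚP.*-comm (ι (suc s)) (𝟙 (suc s ∣? suc k)) ⟩
  𝟙 (suc s ∣? suc k) * ι (suc s)                             ≡⟨ cong (_* ι (suc s)) (sym (trans (𝟙-× (suc s ∣? suc k) (yes G)) (ℚP.*-identityʳ (𝟙 (suc s ∣? suc k))))) ⟩
  𝟙 ((suc s ∣? suc k) ×-dec yes G) * ι (suc s)               ∎
θlogFactor-suc (no ¬G) s k = sym (begin
  𝟙 ((suc s ∣? suc k) ×-dec no ¬G) * ι (suc s)   ≡⟨ cong (_* ι (suc s)) (trans (𝟙-× (suc s ∣? suc k) (no ¬G)) (ℚP.*-zeroʳ (𝟙 (suc s ∣? suc k)))) ⟩
  0ℚ * ι (suc s)                                ≡⟨ ℚP.*-zeroˡ (ι (suc s)) ⟩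
  0ℚ                                            ∎)

θlogFactor-large : ∀ {G : Set} (g : Dec G) s k → k < s → θlogFactor g (suc s) (suc k) ≡ 0ℚ
θlogFactor-large g s k k<s = begin
  θlogFactor g (suc s) (suc k)                        ≡⟨ θlogFactor-suc g s k ⟩
  𝟙 ((suc s ∣? suc k) ×-dec g) * ι (suc s)            ≡⟨ cong (_* ι (suc s)) (𝟙-× (suc s ∣? suc k) g) ⟩
  𝟙 (suc s ∣? suc k) * 𝟙 g * ι (suc s)                ≡⟨ cong (λ x → x * 𝟙 g * ι (suc s)) (𝟙-no (suc s ∣? suc k) ∤) ⟩
  0ℚ * 𝟙 g * ι (suc s)                                ≡⟨ cong (_* ι (suc s)) (ℚP.*-zeroˡ (𝟙 g)) ⟩
  0ℚ * ι (suc s)                                      ≡⟨ ℚP.*-zeroˡ (ι (suc s)) ⟩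
  0ℚ                                                  ∎
  where
  ∤ = λ d → ℕP.<⇒≱ (s≤s k<s) (∣⇒≤ d)

partCount : ℕ → ℕ → (L b : ℕ) → Series
partCount m s L b t = ι (length (filter (λ js → (wsum′ s js ℕP.≟ t) ×-dec allowed? m s js) (vecs L b)))

multiplicityAllowed : ℕ → ℕ → ℕ → ℚ
multiplicityAllowed m s j = 𝟙 ((j ℕP.≟ 0) ⊎-dec good? m s)

𝟙-partition-∷ : ∀ {L} m s t j (js : Vec ℕ L) →
  𝟙 ((wsum′ s (j ∷ js) ℕP.≟ t) ×-dec allowed? m s (j ∷ js)) ≡
  multiplicityAllowed m s j * shift (s ℕ.* j) (λ u → 𝟙 ((wsum′ (suc s) js ℕP.≟ u) ×-dec allowed? m (suc s) js)) t
𝟙-partition-∷ m s t j js = begin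
  𝟙 ((wsum′ s (j ∷ js) ℕP.≟ t) ×-dec allowed? m s (j ∷ js))
    ≡⟨ 𝟙-× (wsum′ s (j ∷ js) ℕP.≟ t) (allowed? m s (j ∷ js)) ⟩
  𝟙 (wsum′ s (j ∷ js) ℕP.≟ t) * 𝟙 (((j ℕP.≟ 0) ⊎-dec good? m s) ×-dec allowed? m (suc s) js)
    ≡⟨ cong₂ _*_ (𝟙≟-shift (s ℕ.* j) w t) (𝟙-× ((j ℕP.≟ 0) ⊎-dec good? m s) (allowed? m (suc s) js)) ⟩
  shift (s ℕ.* j) W t * (c * a)
    ≡⟨ solve 3 (λ x c a → x :* (c :* a) := c :* (a :* x)) refl (shift (s ℕ.* j) W t) c a ⟩
  c * (a * shift (s ℕ.* j) W t)
    ≡⟨ cong (c *_) (sym (shift-scale (s ℕ.* j) a W t)) ⟩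
  c * shift (s ℕ.* j) (λ u → a * W u) t
    ≡⟨ cong (c *_) (shift-cong (s ℕ.* j) (λ u → trans (ℚP.*-comm a (W u)) (sym (𝟙-× (w ℕP.≟ u) (allowed? m (suc s) js)))) t) ⟩
  c * shift (s ℕ.* j) (λ u → 𝟙 ((w ℕP.≟ u) ×-dec allowed? m (suc s) js)) t ∎
  where
  open +-*-Solver
  w = wsum′ (suc s) js
  W = λ u → 𝟙 (w ℕP.≟ u)
  c = multiplicityAllowed m s j
  a = 𝟙 (allowed? m (suc s) js)

partCount-∷ : ∀ m s L b t →
  partCount m s (suc L) b t ≡ ∑[ j < suc b ] (multiplicityAllowed m s j * shift (s ℕ.* j) (partCount m (suc s) L b) t)
partCount-∷ m s L b t = begin
  partCount m s (suc L) b t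
    ≡⟨ ι-length-filter _ (vecs (suc L) b) ⟩
  sumℚ (map P (vecs (suc L) b))
    ≡⟨ sumℚ-concatMap P (λ j → map (j ∷_) (vecs L b)) (upTo (suc b)) ⟩
  sumℚ (map (λ j → sumℚ (map P (map (j ∷_) (vecs L b)))) (upTo (suc b)))
    ≡⟨ sumℚ-upTo (λ j → sumℚ (map P (map (j ∷_) (vecs L b)))) (suc b) ⟩
  ∑[ j < suc b ] sumℚ (map P (map (j ∷_) (vecs L b)))
    ≡⟨ ∑-cong (suc b) (λ j _ → row j) ⟩
  ∑[ j < suc b ] (multiplicityAllowed m s j * shift (s ℕ.* j) (partCount m (suc s) L b) t) ∎
  where
  P : Vec ℕ (suc L) → ℚ
  P js = 𝟙 ((wsum′ s js ℕP.≟ t) ×-dec allowed? m s js)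
  Q : Vec ℕ L → ℕ → ℚ
  Q js u = 𝟙 ((wsum′ (suc s) js ℕP.≟ u) ×-dec allowed? m (suc s) js)
  row : ∀ j → sumℚ (map P (map (j ∷_) (vecs L b))) ≡ multiplicityAllowed m s j * shift (s ℕ.* j) (partCount m (suc s) L b) t
  row j = begin
    sumℚ (map P (map (j ∷_) (vecs L b)))
      ≡⟨ cong sumℚ (sym (Listₚ.map-∘ (vecs L b))) ⟩
    sumℚ (map (λ js → P (j ∷ js)) (vecs L b))
      ≡⟨ sumℚ-cong (𝟙-partition-∷ m s t j) (vecs L b) ⟩
    sumℚ (map (λ js → multiplicityAllowed m s j * shift (s ℕ.* j) (Q js) t) (vecs L b))
      ≡⟨ sumℚ-*ˡ (multiplicityAllowed m s j) (λ js → shift (s ℕ.* j) (Q js) t) (vecs L b) ⟩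
    multiplicityAllowed m s j * sumℚ (map (λ js → shift (s ℕ.* j) (Q js) t) (vecs L b))
      ≡⟨ cong (multiplicityAllowed m s j *_) (shift-sumℚ (s ℕ.* j) Q t (vecs L b)) ⟩
    multiplicityAllowed m s j * shift (s ℕ.* j) (λ u → sumℚ (map (λ js → Q js u) (vecs L b))) t
      ≡⟨ cong (multiplicityAllowed m s j *_) (shift-cong (s ℕ.* j) (λ u → sym (ι-length-filter _ (vecs L b))) t) ⟩
    multiplicityAllowed m s j * shift (s ℕ.* j) (partCount m (suc s) L b) t ∎

partFactor : ℕ → ℕ → Series
partFactor m S = factor (good? m S) S

partCount≡∏ : ∀ m s L b t → t ≤ b → partCount m (suc s) L b t ≡ ∏ₛ (partFactor m) (suc s) L t
partCount≡∏ m s zero    b zero    _   = refl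
partCount≡∏ m s zero    b (suc t) _   = refl
partCount≡∏ m s (suc L) b t       t≤b = begin
  partCount m S (suc L) b t
    ≡⟨ partCount-∷ m S L b t ⟩
  ∑[ j < suc b ] (c j * shift (S ℕ.* j) Rest t)
    ≡⟨ ∑-cong (suc b) (λ j _ → cong (c j *_) (sym (trans (⊛-monomialˡ (S ℕ.* j) 1ℚ Rest t) (ℚP.*-identityˡ (shift (S ℕ.* j) Rest t))))) ⟩
  ∑[ j < suc b ] (c j * (monomial (S ℕ.* j) 1ℚ ⊛ Rest) t)
    ≡⟨ sym (⊛-∑ˡ (suc b) c (λ j → monomial (S ℕ.* j) 1ℚ) Rest t) ⟩
  ((λ u → ∑[ j < suc b ] (c j * monomial (S ℕ.* j) 1ℚ u)) ⊛ Rest) t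
    ≡⟨ ⊛-cong≤ t (λ u u≤t → factor-partial (good? m S) s b u (ℕP.≤-trans u≤t t≤b))
                 (λ u u≤t → partCount≡∏ m S L b u (ℕP.≤-trans u≤t t≤b)) ⟩
  (partFactor m S ⊛ ∏ₛ (partFactor m) (suc S) L) t ∎
  where
  S = suc s
  c = multiplicityAllowed m S
  Rest = partCount m (suc S) L b

partFactor-below : ∀ m s t → t < s → partFactor m s t ≡ 1ₛ t
partFactor-below m (suc s) t t<s = factor-below (good? m (suc s)) s t t<s

partitionSeries : ℕ → Series
partitionSeries m t = ι (partitionCount′ m t)

divisorSeries : ℕ → Series
divisorSeries m t = ι (sigma′ m t)

partitionSeries-∏ : ∀ m t u → u ≤ t → partitionSeries m u ≡ ∏ₛ (partFactor m) 1 t u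
partitionSeries-∏ m t u u≤t with ℕP.m≤n⇒∃[o]m+o≡n u≤t
... | r , refl = begin
  partCount m 1 u u u                 ≡⟨ partCount≡∏ m 0 u u u ℕP.≤-refl ⟩
  ∏ₛ (partFactor m) 1 u u             ≡⟨ sym (∏ₛ-stable (partFactor-below m) 1 u r u (s≤s ℕP.≤-refl)) ⟩
  ∏ₛ (partFactor m) 1 (u ℕ.+ r) u     ∎

partLogFactor : ℕ → ℕ → Series
partLogFactor m S = θlogFactor (good? m S) S

∑ₛ-partLogFactor : ∀ m L k → k ≤ L → ∑ₛ (partLogFactor m) 1 L k ≡ divisorSeries m k
∑ₛ-partLogFactor m L zero _ = trans (∑ₛ-∑ (partLogFactor m) 1 L 0) (∑-zero L (λ i _ → at-zero (good? m (suc i)) i))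
  where
  at-zero : ∀ {G : Set} (g : Dec G) s → θlogFactor g (suc s) 0 ≡ 0ℚ
  at-zero (yes _) s = ℚP.*-zeroʳ (ι (suc s))
  at-zero (no _)  s = refl
∑ₛ-partLogFactor m L (suc k) k<L = begin
  ∑ₛ (partLogFactor m) 1 L (suc k)
    ≡⟨ ∑ₛ-∑ (partLogFactor m) 1 L (suc k) ⟩
  ∑[ i < L ] partLogFactor m (suc i) (suc k)
    ≡⟨ ∑-vanishing-tail (suc k) L _ k<L (λ i k<i → θlogFactor-large (good? m (suc i)) i k k<i) ⟩
  ∑[ i < suc k ] partLogFactor m (suc i) (suc k)
    ≡⟨ ∑-cong (suc k) (λ i _ → θlogFactor-suc (good? m (suc i)) i k) ⟩
  ∑[ i < suc k ] (𝟙 (P? (1 ℕ.+ i)) * ι (1 ℕ.+ i))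
    ≡⟨ sym (sumℚ-range (λ d → 𝟙 (P? d) * ι d) 1 (suc k)) ⟩
  sumℚ (map (λ d → 𝟙 (P? d) * ι d) (range 1 (suc k)))
    ≡⟨ sym (sumℚ-filter P? ι (range 1 (suc k))) ⟩
  sumℚ (map ι (filter P? (range 1 (suc k))))
    ≡⟨ sym (ι-sum (filter P? (range 1 (suc k)))) ⟩
  divisorSeries m (suc k) ∎
  where
  P? = λ d → (d ∣? suc k) ×-dec good? m d

θ-partitionSeries : ∀ m → θ (partitionSeries m) ≈ divisorSeries m ⊛ partitionSeries m
θ-partitionSeries m t = begin
  ι t * partitionSeries m t                 ≡⟨ cong (ι t *_) (partitionSeries-∏ m t t ℕP.≤-refl) ⟩
  θ (∏ₛ (partFactor m) 1 t) t               ≡⟨ θ-∏ (λ s → θ-factor (good? m (suc s)) s) 0 t t ⟩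
  (∑ₛ (partLogFactor m) 1 t ⊛ ∏ₛ (partFactor m) 1 t) t
    ≡⟨ ⊛-cong≤ t (λ k k≤t → ∑ₛ-partLogFactor m t k k≤t) (λ u u≤t → sym (partitionSeries-∏ m t u u≤t)) ⟩
  (divisorSeries m ⊛ partitionSeries m) t   ∎

-- The logarithmic derivative of a series with constant term 1

signℚ-suc : ∀ k → signℚ (suc k) ≡ - signℚ k
signℚ-suc zero          = refl
signℚ-suc (suc zero)    = refl
signℚ-suc (suc (suc k)) = signℚ-suc k

∑-alternating-telescope : ∀ K (u : ℕ → ℚ) → ∑[ k < K ] (signℚ k * (u k + u (suc k))) ≡ u 0 - signℚ K * u K
∑-alternating-telescope zero    u = sym (trans (cong (λ x → u 0 - x) (ℚP.*-identityˡ (u 0))) (ℚP.+-inverseʳ (u 0)))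
∑-alternating-telescope (suc K) u = begin
  ∑[ k < suc K ] (signℚ k * (u k + u (suc k)))
    ≡⟨ ∑-last K (λ k → signℚ k * (u k + u (suc k))) ⟩
  ∑[ k < K ] (signℚ k * (u k + u (suc k))) + signℚ K * (u K + u (suc K))
    ≡⟨ cong (_+ signℚ K * (u K + u (suc K))) (∑-alternating-telescope K u) ⟩
  (u 0 - signℚ K * u K) + signℚ K * (u K + u (suc K))
    ≡⟨ solve 4 (λ e s x y → (e :- s :* x) :+ s :* (x :+ y) := e :- (:- s) :* y) refl (u 0) (signℚ K) (u K) (u (suc K)) ⟩
  u 0 - (- signℚ K) * u (suc K)
    ≡⟨ cong (λ s → u 0 - s * u (suc K)) (sym (signℚ-suc K)) ⟩
  u 0 - signℚ (suc K) * u (suc K) ∎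
  where open +-*-Solver

alternating : Series → ℕ → Series
alternating A K t = ∑[ k < K ] (signℚ k * (A ^ k) t)

alternating-⊛ : ∀ {A} → x^ 1 ∣ A → ∀ K t → t < K → (alternating A K ⊛ (1ₛ ⊕ A)) t ≡ 1ₛ t
alternating-⊛ {A} A0 K t t<K = begin
  (G ⊛ (1ₛ ⊕ A)) t
    ≡⟨ ⊛-distribˡ G 1ₛ A t ⟩
  (G ⊛ 1ₛ) t + (G ⊛ A) t
    ≡⟨ cong₂ _+_ (⊛-identityʳ G t) (trans (⊛-∑ˡ K signℚ (A ^_) A t) (∑-cong K (λ k _ → cong (signℚ k *_) (⊛-comm (A ^ k) A t)))) ⟩
  G t + ∑[ k < K ] (signℚ k * (A ^ suc k) t)
    ≡⟨ sym (∑-+ K _ _) ⟩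
  ∑[ k < K ] (signℚ k * (A ^ k) t + signℚ k * (A ^ suc k) t)
    ≡⟨ ∑-cong K (λ k _ → sym (ℚP.*-distribˡ-+ (signℚ k) _ _)) ⟩
  ∑[ k < K ] (signℚ k * ((A ^ k) t + (A ^ suc k) t))
    ≡⟨ ∑-alternating-telescope K (λ k → (A ^ k) t) ⟩
  1ₛ t - signℚ K * (A ^ K) t
    ≡⟨ cong (λ x → 1ₛ t - signℚ K * x) (^-x^∣ A0 K t t<K) ⟩
  1ₛ t - signℚ K * 0ℚ
    ≡⟨ cong (λ x → 1ₛ t - x) (ℚP.*-zeroʳ (signℚ K)) ⟩
  1ₛ t - 0ℚ
    ≡⟨ ℚP.+-identityʳ (1ₛ t) ⟩
  1ₛ t ∎
  where
  G = alternating A K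

dropConst : Series → Series
dropConst a zero    = 0ℚ
dropConst a (suc i) = a (suc i)

dropConst-x^∣ : ∀ a → x^ 1 ∣ dropConst a
dropConst-x^∣ a zero    _        = refl
dropConst-x^∣ a (suc t) (s≤s ())

dropConst-unit : ∀ {a} → a 0 ≡ 1ℚ → a ≈ 1ₛ ⊕ dropConst a
dropConst-unit a0 zero    = trans a0 (sym (ℚP.+-identityʳ 1ℚ))
dropConst-unit a0 (suc i) = sym (ℚP.+-identityˡ _)

θ-dropConst : ∀ a → θ (dropConst a) ≈ θ a
θ-dropConst a zero    = trans (θ-zero (dropConst a)) (sym (θ-zero a))
θ-dropConst a (suc i) = refl

-- θ log (1 + A) = Σ_k (-A)^k θA, for A = a - 1
logDerivative : Series → Series
logDerivative a n = ∑[ k < n ] (signℚ k * (A ^ k ⊛ θ A) n)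
  where A = dropConst a

logDerivative-⊛ : ∀ a → a 0 ≡ 1ℚ → logDerivative a ⊛ a ≈ θ a
logDerivative-⊛ a a0 n = begin
  (logDerivative a ⊛ a) n
    ≡⟨ ⊛-congˡ≤ n a (λ j j≤n → trans (all-terms j (ℕP.m≤n⇒m≤1+n j≤n)) (sym (⊛-∑ˡ K signℚ (A ^_) (θ A) j))) ⟩
  ((G ⊛ θ A) ⊛ a) n           ≡⟨ ⊛-assoc G (θ A) a n ⟩
  (G ⊛ (θ A ⊛ a)) n           ≡⟨ ⊛-congʳ≤ n G (λ j _ → ⊛-comm (θ A) a j) ⟩
  (G ⊛ (a ⊛ θ A)) n           ≡⟨ sym (⊛-assoc G a (θ A) n) ⟩
  ((G ⊛ a) ⊛ θ A) n           ≡⟨ ⊛-congˡ≤ n (θ A) (λ j j≤n → inverse j (s≤s j≤n)) ⟩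
  (1ₛ ⊛ θ A) n                ≡⟨ ⊛-identityˡ (θ A) n ⟩
  θ A n                       ≡⟨ θ-dropConst a n ⟩
  θ a n                       ∎
  where
  A = dropConst a
  K = suc n
  G = alternating A K
  inverse : ∀ j → j < K → (G ⊛ a) j ≡ 1ₛ j
  inverse j j<K = trans (⊛-congʳ≤ j G (λ u _ → dropConst-unit a0 u)) (alternating-⊛ (dropConst-x^∣ a) K j j<K)
  high-terms-vanish : ∀ j k → j ≤ k → (A ^ k ⊛ θ A) j ≡ 0ℚ
  high-terms-vanish j k j≤k = ⊛-x^∣ k 1 (^-x^∣ (dropConst-x^∣ a) k) θA0 j
    (ℕP.≤-trans (s≤s j≤k) (ℕP.≤-reflexive (ℕP.+-comm 1 k)))
    where
    θA0 : x^ 1 ∣ θ A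
    θA0 zero    _        = θ-zero A
    θA0 (suc t) (s≤s ())
  all-terms : ∀ j → j ≤ K → logDerivative a j ≡ ∑[ k < K ] (signℚ k * (A ^ k ⊛ θ A) j)
  all-terms j j≤K = sym (∑-vanishing-tail j K _ j≤K
    (λ k j≤k → trans (cong (signℚ k *_) (high-terms-vanish j k j≤k)) (ℚP.*-zeroʳ (signℚ k))))

⊛-cancelʳ : ∀ {f g a : Series} → a 0 ≡ 1ℚ → f ⊛ a ≈ g ⊛ a → f ≈ g
⊛-cancelʳ {f} {g} {a} a0 eq = <-rec _ step
  where
  by-a0 : ∀ {x y} → x * a 0 ≡ y * a 0 → x ≡ y
  by-a0 {x} {y} e = begin
    x             ≡⟨ sym (ℚP.*-identityʳ x) ⟩
    x * 1ℚ        ≡⟨ cong (x *_) (sym a0) ⟩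
    x * a 0       ≡⟨ e ⟩
    y * a 0       ≡⟨ cong (y *_) a0 ⟩
    y * 1ℚ        ≡⟨ ℚP.*-identityʳ y ⟩
    y             ∎
  step : ∀ n → (∀ {m} → m < n → f m ≡ g m) → f n ≡ g n
  step zero    _   = by-a0 (eq 0)
  step (suc n) rec = by-a0 (+-cancelˡ ((f ⊛ tail a) n) _ _ (begin
    (f ⊛ tail a) n + f (suc n) * a 0   ≡⟨ sym (⊛-snoc f a n) ⟩
    (f ⊛ a) (suc n)                    ≡⟨ eq (suc n) ⟩
    (g ⊛ a) (suc n)                    ≡⟨ ⊛-snoc g a n ⟩
    (g ⊛ tail a) n + g (suc n) * a 0   ≡⟨ cong (_+ g (suc n) * a 0) (⊛-congˡ≤ n (tail a) (λ i i≤n → sym (rec (s≤s i≤n)))) ⟩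
    (f ⊛ tail a) n + g (suc n) * a 0   ∎))

-- Multinomial expansion

module Bin = Binomial commutativeSemiring
open RawMonoid (CommutativeRing.+-rawMonoid seriesRing) using (_×_)

×-eval : ∀ c f t → (c × f) t ≡ ι c * f t
×-eval zero    f t = sym (ℚP.*-zeroˡ (f t))
×-eval (suc c) f t = begin
  f t + (c × f) t          ≡⟨ cong (f t +_) (×-eval c f t) ⟩
  f t + ι c * f t          ≡⟨ cong (_+ ι c * f t) (sym (ℚP.*-identityˡ (f t))) ⟩
  1ℚ * f t + ι c * f t     ≡⟨ sym (ℚP.*-distribʳ-+ (f t) 1ℚ (ι c)) ⟩
  (1ℚ + ι c) * f t         ≡⟨ cong (_* f t) (sym (ι-+ 1 c)) ⟩
  ι (suc c) * f t          ∎

foldr-eval : ∀ N (V : Fin N → Series) (F : ℕ → ℚ) t → (∀ i → V i t ≡ F (toℕ i)) →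
             Vector.foldr _⊕_ 0ₛ V t ≡ ∑< N F
foldr-eval zero    V F t eq = refl
foldr-eval (suc N) V F t eq =
  cong₂ _+_ (eq Fin.zero) (foldr-eval N (λ i → V (Fin.suc i)) (λ i → F (suc i)) t (λ i → eq (Fin.suc i)))

binomial-theorem : ∀ (f g : Series) k t →
  ((f ⊕ g) ^ k) t ≡ ∑[ j < suc k ] (ι (k C j) * (f ^ j ⊛ g ^ (k ∸ j)) t)
binomial-theorem f g k t = trans (Bin.theorem k f g t)
  (foldr-eval (suc k) (λ i → (k C toℕ i) × Bin.binomial f g k i) (λ j → ι (k C j) * (f ^ j ⊛ g ^ (k ∸ j)) t) t
    (λ i → ×-eval (k C toℕ i) (Bin.binomial f g k i) t))

k!/j!≡kCj*[k∸j]! : ∀ k j → j ≤ k → ι (k !) * 1/[ j ]! ≡ ι (k C j) * ι ((k ∸ j) !)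
k!/j!≡kCj*[k∸j]! k j j≤k = begin
  ι (k !) * 1/[ j ]!
    ≡⟨ cong (λ z → ι z * 1/[ j ]!) (sym k!≡) ⟩
  ι ((k C j) ℕ.* (j ! ℕ.* (k ∸ j) !)) * 1/[ j ]!
    ≡⟨ cong (_* 1/[ j ]!) (trans (ι-* (k C j) _) (cong (ι (k C j) *_) (ι-* (j !) ((k ∸ j) !)))) ⟩
  (ι (k C j) * (ι (j !) * ι ((k ∸ j) !))) * 1/[ j ]!
    ≡⟨ solve 4 (λ c a b i → (c :* (a :* b)) :* i := (c :* b) :* (a :* i)) refl (ι (k C j)) (ι (j !)) (ι ((k ∸ j) !)) 1/[ j ]! ⟩
  (ι (k C j) * ι ((k ∸ j) !)) * (ι (j !) * 1/[ j ]!)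
    ≡⟨ cong ((ι (k C j) * ι ((k ∸ j) !)) *_) (ι*1/ι (j !) {{j !≢0}}) ⟩
  (ι (k C j) * ι ((k ∸ j) !)) * 1ℚ
    ≡⟨ ℚP.*-identityʳ _ ⟩
  ι (k C j) * ι ((k ∸ j) !) ∎
  where
  open +-*-Solver
  k!≡ : (k C j) ℕ.* (j ! ℕ.* (k ∸ j) !) ≡ k !
  k!≡ = trans (cong (ℕ._* (j ! ℕ.* (k ∸ j) !)) (nCk≡n!/k![n-k]! j≤k))
              (m/n*n≡m {{ℕP.m*n≢0 (j !) ((k ∸ j) !) {{j !≢0}} {{(k ∸ j) !≢0}}}} (k![n∸k]!∣n! j≤k))

monomialProduct : ∀ {L} → Series → ℕ → Vec ℕ L → ℚ
monomialProduct a s []       = 1ℚ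
monomialProduct a s (j ∷ js) = (a s ^ℚ j) * monomialProduct a (suc s) js

1/factProd : ∀ {L} → Vec ℕ L → ℚ
1/factProd js = 1/ι (factProd js) {{factProd≢0 js}}

multinomialTerm : ∀ {L} → Series → ℕ → ℕ → ℕ → Vec ℕ L → ℚ
multinomialTerm a s k t js = 𝟙 ((vsum js ℕP.≟ k) ×-dec (wsum′ s js ℕP.≟ t)) * (1/factProd js * monomialProduct a s js)

multinomialSum : Series → ℕ → (L b : ℕ) → ℕ → ℕ → ℚ
multinomialSum a s L b k t = sumℚ (map (multinomialTerm a s k t) (vecs L b))

multinomialTerm-∷ : ∀ {L} a s k t j (js : Vec ℕ L) →
  multinomialTerm a s k t (j ∷ js) ≡
  (1/[ j ]! * (a s ^ℚ j)) * shift j (λ k′ → shift (s ℕ.* j) (λ u → multinomialTerm a (suc s) k′ u js) t) k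
multinomialTerm-∷ a s k t j js = begin
  𝟙 ((j ℕ.+ vsum js ℕP.≟ k) ×-dec (s ℕ.* j ℕ.+ w ℕP.≟ t)) * (1/factProd (j ∷ js) * ((a s ^ℚ j) * M))
    ≡⟨ cong₂ _*_ (𝟙-× (j ℕ.+ vsum js ℕP.≟ k) (s ℕ.* j ℕ.+ w ℕP.≟ t))
                 (cong (_* ((a s ^ℚ j) * M)) (1/ι-* (j !) (factProd js) {{j !≢0}} {{factProd≢0 js}})) ⟩
  (𝟙 (j ℕ.+ vsum js ℕP.≟ k) * 𝟙 (s ℕ.* j ℕ.+ w ℕP.≟ t)) * ((1/[ j ]! * 1/factProd js) * ((a s ^ℚ j) * M))
    ≡⟨ cong₂ (λ x y → (x * y) * ((1/[ j ]! * 1/factProd js) * ((a s ^ℚ j) * M))) (𝟙≟-shift j (vsum js) k) (𝟙≟-shift (s ℕ.* j) w t) ⟩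
  (shift j F k * shift (s ℕ.* j) H t) * ((1/[ j ]! * 1/factProd js) * ((a s ^ℚ j) * M))
    ≡⟨ solve 6 (λ f h i p A m → (f :* h) :* ((i :* p) :* (A :* m)) := (i :* A) :* (f :* (h :* (p :* m)))) refl
         (shift j F k) (shift (s ℕ.* j) H t) 1/[ j ]! (1/factProd js) (a s ^ℚ j) M ⟩
  c * (shift j F k * (shift (s ℕ.* j) H t * R))
    ≡⟨ cong (λ z → c * (shift j F k * z)) (trans (ℚP.*-comm _ R) (sym (shift-scale (s ℕ.* j) R H t))) ⟩
  c * (shift j F k * shift (s ℕ.* j) (λ u → R * H u) t)
    ≡⟨ cong (c *_) (trans (ℚP.*-comm (shift j F k) _) (sym (shift-scale j (shift (s ℕ.* j) (λ u → R * H u) t) F k))) ⟩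
  c * shift j (λ k′ → shift (s ℕ.* j) (λ u → R * H u) t * F k′) k
    ≡⟨ cong (c *_) (shift-cong j (λ k′ → trans (ℚP.*-comm _ (F k′)) (trans (sym (shift-scale (s ℕ.* j) (F k′) (λ u → R * H u) t))
         (shift-cong (s ℕ.* j) (λ u → regroup k′ u) t))) k) ⟩
  c * shift j (λ k′ → shift (s ℕ.* j) (λ u → multinomialTerm a (suc s) k′ u js) t) k ∎
  where
  open +-*-Solver
  w = wsum′ (suc s) js
  M = monomialProduct a (suc s) js
  c = 1/[ j ]! * (a s ^ℚ j)
  F = λ k′ → 𝟙 (vsum js ℕP.≟ k′)
  H = λ u → 𝟙 (w ℕP.≟ u)
  R = 1/factProd js * M
  regroup : ∀ k′ u → F k′ * (R * H u) ≡ multinomialTerm a (suc s) k′ u js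
  regroup k′ u = trans (solve 3 (λ f r h → f :* (r :* h) := (f :* h) :* r) refl (F k′) R (H u))
                       (cong (_* R) (sym (𝟙-× (vsum js ℕP.≟ k′) (w ℕP.≟ u))))

multinomialSum-∷ : ∀ a s L b k t → multinomialSum a s (suc L) b k t ≡
  ∑[ j < suc b ] ((1/[ j ]! * (a s ^ℚ j)) * shift j (λ k′ → shift (s ℕ.* j) (multinomialSum a (suc s) L b k′) t) k)
multinomialSum-∷ a s L b k t = begin
  sumℚ (map T (vecs (suc L) b))
    ≡⟨ sumℚ-concatMap T (λ j → map (j ∷_) (vecs L b)) (upTo (suc b)) ⟩
  sumℚ (map (λ j → sumℚ (map T (map (j ∷_) (vecs L b)))) (upTo (suc b)))
    ≡⟨ sumℚ-upTo (λ j → sumℚ (map T (map (j ∷_) (vecs L b)))) (suc b) ⟩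
  ∑[ j < suc b ] sumℚ (map T (map (j ∷_) (vecs L b)))
    ≡⟨ ∑-cong (suc b) (λ j _ → row j) ⟩
  _ ∎
  where
  T = multinomialTerm a s k t
  row : ∀ j → sumℚ (map T (map (j ∷_) (vecs L b))) ≡
    (1/[ j ]! * (a s ^ℚ j)) * shift j (λ k′ → shift (s ℕ.* j) (multinomialSum a (suc s) L b k′) t) k
  row j = begin
    sumℚ (map T (map (j ∷_) xs))                 ≡⟨ cong sumℚ (sym (Listₚ.map-∘ xs)) ⟩
    sumℚ (map (λ js → T (j ∷ js)) xs)            ≡⟨ sumℚ-cong (multinomialTerm-∷ a s k t j) xs ⟩
    sumℚ (map (λ js → c * shift j (λ k′ → shift (s ℕ.* j) (λ u → multinomialTerm a (suc s) k′ u js) t) k) xs)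
      ≡⟨ sumℚ-*ˡ c (λ js → shift j (λ k′ → shift (s ℕ.* j) (λ u → multinomialTerm a (suc s) k′ u js) t) k) xs ⟩
    c * sumℚ (map (λ js → shift j (λ k′ → shift (s ℕ.* j) (λ u → multinomialTerm a (suc s) k′ u js) t) k) xs)
      ≡⟨ cong (c *_) (shift-sumℚ j (λ js k′ → shift (s ℕ.* j) (λ u → multinomialTerm a (suc s) k′ u js) t) k xs) ⟩
    c * shift j (λ k′ → sumℚ (map (λ js → shift (s ℕ.* j) (λ u → multinomialTerm a (suc s) k′ u js) t) xs)) k
      ≡⟨ cong (c *_) (shift-cong j (λ k′ → shift-sumℚ (s ℕ.* j) (λ js u → multinomialTerm a (suc s) k′ u js) t xs) k) ⟩
    c * shift j (λ k′ → shift (s ℕ.* j) (multinomialSum a (suc s) L b k′) t) k ∎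
    where
    xs = vecs L b
    c = 1/[ j ]! * (a s ^ℚ j)

polynomial : Series → ℕ → ℕ → Series
polynomial a = ∑ₛ (λ i → monomial i (a i))

-- Induction on the number of variables: the binomial theorem splits off a_s x^s.
multinomial-theorem : ∀ a s L b k t → k ≤ b → ι (k !) * multinomialSum a s L b k t ≡ (polynomial a s L ^ k) t
multinomial-theorem a s zero    b zero    zero    _ = refl
multinomial-theorem a s zero    b zero    (suc t) _ = refl
multinomial-theorem a s zero    b (suc k) t       _ =
  trans (ℚP.*-zeroʳ (ι (suc k !))) (sym (⊛-zeroˡ (polynomial a s 0 ^ k) (λ _ → refl) t))
multinomial-theorem a s (suc L) b k t k≤b with ℕP.m≤n⇒∃[o]m+o≡n k≤b
... | r , refl = begin
  ι (k !) * multinomialSum a s (suc L) (k ℕ.+ r) k t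
    ≡⟨ cong (ι (k !) *_) (multinomialSum-∷ a s L (k ℕ.+ r) k t) ⟩
  ι (k !) * ∑< (suc k ℕ.+ r) T
    ≡⟨ sym (∑-*ˡ (suc k ℕ.+ r) (ι (k !)) T) ⟩
  ∑[ j < suc k ℕ.+ r ] (ι (k !) * T j)
    ≡⟨ ∑-vanishing-tail (suc k) (suc k ℕ.+ r) _ (ℕP.m≤m+n (suc k) r) (λ j k<j → trans
         (cong (λ z → ι (k !) * (c j * z)) (shift-< j (λ k′ → shift (s ℕ.* j) (multinomialSum a (suc s) L (k ℕ.+ r) k′) t) k k<j)) (trans (cong (ι (k !) *_) (ℚP.*-zeroʳ (c j))) (ℚP.*-zeroʳ (ι (k !))))) ⟩
  ∑[ j < suc k ] (ι (k !) * T j)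
    ≡⟨ ∑-cong (suc k) (λ j j<k → term j (ℕP.≤-pred j<k)) ⟩
  ∑[ j < suc k ] (ι (k C j) * (M ^ j ⊛ P ^ (k ∸ j)) t)
    ≡⟨ sym (binomial-theorem M P k t) ⟩
  (polynomial a s (suc L) ^ k) t ∎
  where
  M = monomial s (a s)
  P = polynomial a (suc s) L
  c = λ j → 1/[ j ]! * (a s ^ℚ j)
  T = λ j → c j * shift j (λ k′ → shift (s ℕ.* j) (multinomialSum a (suc s) L (k ℕ.+ r) k′) t) k
  term : ∀ j → j ≤ k → ι (k !) * T j ≡ ι (k C j) * (M ^ j ⊛ P ^ (k ∸ j)) t
  term j j≤k = begin
    ι (k !) * (c j * shift j E k)
      ≡⟨ cong (λ z → ι (k !) * (c j * z)) (shift-≥ j E k j≤k) ⟩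
    ι (k !) * ((1/[ j ]! * (a s ^ℚ j)) * E (k ∸ j))
      ≡⟨ solve 4 (λ K i A S → K :* ((i :* A) :* S) := (K :* i) :* (A :* S)) refl (ι (k !)) 1/[ j ]! (a s ^ℚ j) (E (k ∸ j)) ⟩
    (ι (k !) * 1/[ j ]!) * ((a s ^ℚ j) * E (k ∸ j))
      ≡⟨ cong (_* ((a s ^ℚ j) * E (k ∸ j))) (k!/j!≡kCj*[k∸j]! k j j≤k) ⟩
    (ι (k C j) * ι ((k ∸ j) !)) * ((a s ^ℚ j) * E (k ∸ j))
      ≡⟨ solve 4 (λ C F A S → (C :* F) :* (A :* S) := C :* (A :* (F :* S))) refl (ι (k C j)) (ι ((k ∸ j) !)) (a s ^ℚ j) (E (k ∸ j)) ⟩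
    ι (k C j) * ((a s ^ℚ j) * (ι ((k ∸ j) !) * E (k ∸ j)))
      ≡⟨ cong (λ z → ι (k C j) * ((a s ^ℚ j) * z)) (trans (sym (shift-scale (s ℕ.* j) (ι ((k ∸ j) !)) _ t))
           (shift-cong (s ℕ.* j) (λ u → multinomial-theorem a (suc s) L (k ℕ.+ r) (k ∸ j) u
             (ℕP.≤-trans (ℕP.m∸n≤m k j) (ℕP.m≤m+n k r))) t)) ⟩
    ι (k C j) * ((a s ^ℚ j) * shift (s ℕ.* j) (P ^ (k ∸ j)) t)
      ≡⟨ cong (ι (k C j) *_) (sym (trans (⊛-congˡ≤ t (P ^ (k ∸ j)) (λ u _ → monomial-^ s (a s) j u))
           (⊛-monomialˡ (s ℕ.* j) (a s ^ℚ j) (P ^ (k ∸ j)) t))) ⟩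
    ι (k C j) * (M ^ j ⊛ P ^ (k ∸ j)) t ∎
    where
    open +-*-Solver
    E = λ k′ → shift (s ℕ.* j) (multinomialSum a (suc s) L (k ℕ.+ r) k′) t

polynomial-below : ∀ a s L u → u < s → polynomial a s L u ≡ 0ℚ
polynomial-below a s zero    u u<s = refl
polynomial-below a s (suc L) u u<s = begin
  monomial s (a s) u + polynomial a (suc s) L u   ≡⟨ cong₂ _+_ (monomial-other s (a s) u (ℕP.<⇒≢ u<s)) (polynomial-below a (suc s) L u (ℕP.m<n⇒m<1+n u<s)) ⟩
  0ℚ + 0ℚ                                        ≡⟨ ℚP.+-identityʳ 0ℚ ⟩
  0ℚ                                             ∎

polynomial-inside : ∀ a s L u → s ≤ u → u < s ℕ.+ L → polynomial a s L u ≡ a u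
polynomial-inside a s (suc L) u s≤u u<s+L with u ℕP.≟ s
... | yes refl = begin
  monomial u (a u) u + polynomial a (suc u) L u  ≡⟨ cong₂ _+_ (monomial-self u (a u)) (polynomial-below a (suc u) L u ℕP.≤-refl) ⟩
  a u + 0ℚ                                       ≡⟨ ℚP.+-identityʳ (a u) ⟩
  a u                                            ∎
... | no u≢s = begin
  monomial s (a s) u + polynomial a (suc s) L u  ≡⟨ cong₂ _+_ (monomial-other s (a s) u u≢s)
                                                      (polynomial-inside a (suc s) L u (ℕP.≤∧≢⇒< s≤u (λ eq → u≢s (sym eq)))
                                                        (subst (u <_) (ℕP.+-suc s L) u<s+L)) ⟩
  0ℚ + a u                                       ≡⟨ ℚP.+-identityˡ (a u) ⟩
  a u                                            ∎
polynomial-inside a s zero u s≤u u<s+L = ⊥-elim (ℕP.<⇒≱ u<s+L (ℕP.≤-trans (ℕP.≤-reflexive (ℕP.+-identityʳ s)) s≤u))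

polynomial-dropConst : ∀ a L u → u ≤ L → polynomial a 1 L u ≡ dropConst a u
polynomial-dropConst a L zero    _   = polynomial-below a 1 L 0 (s≤s z≤n)
polynomial-dropConst a L (suc u) u≤L = polynomial-inside a 1 L (suc u) (s≤s z≤n) (s≤s u≤L)

-- f^(k+1) - g^(k+1) = f (f^k - g^k) + (f - g) g^k, each term divisible by x^(L+k+1)
^-agree : ∀ {f g} L → x^ 1 ∣ f → x^ 1 ∣ g → (∀ u → u ≤ L → f u ≡ g u) →
          ∀ k t → t < L ℕ.+ k → (f ^ k) t ≡ (g ^ k) t
^-agree {f} {g} L f0 g0 f≡g k t t<L+k = p-q≡0⇒p≡q _ _ (difference k t t<L+k)
  where
  difference : ∀ k → x^ (L ℕ.+ k) ∣ (λ t → (f ^ k) t - (g ^ k) t)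
  difference zero    t _  = ℚP.+-inverseʳ (1ₛ t)
  difference (suc k) t lt = begin
    (f ⊛ F) t - (g ⊛ G) t
      ≡⟨ solve 3 (λ x y z → x :- z := (x :- y) :+ (y :- z)) refl ((f ⊛ F) t) ((f ⊛ G) t) ((g ⊛ G) t) ⟩
    ((f ⊛ F) t - (f ⊛ G) t) + ((f ⊛ G) t - (g ⊛ G) t)
      ≡⟨ cong₂ (λ x y → (x - y) + ((f ⊛ G) t - (g ⊛ G) t)) (⊛-comm f F t) (⊛-comm f G t) ⟩
    ((F ⊛ f) t - (G ⊛ f) t) + ((f ⊛ G) t - (g ⊛ G) t)
      ≡⟨ sym (cong₂ _+_ (⊛-−ˡ F G f t) (⊛-−ˡ f g G t)) ⟩
    ((λ i → F i - G i) ⊛ f) t + ((λ i → f i - g i) ⊛ G) t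
      ≡⟨ cong₂ _+_ (⊛-x^∣ (L ℕ.+ k) 1 (difference k) f0 t (subst (t <_) (sym (trans (ℕP.+-assoc L k 1) (cong (L ℕ.+_) (ℕP.+-comm k 1)))) lt))
                   (⊛-x^∣ (suc L) k f-g (^-x^∣ g0 k) t (subst (t <_) (ℕP.+-suc L k) lt)) ⟩
    0ℚ + 0ℚ
      ≡⟨ ℚP.+-identityʳ 0ℚ ⟩
    0ℚ ∎
    where
    open +-*-Solver
    F = f ^ k
    G = g ^ k
    f-g : x^ suc L ∣ (λ i → f i - g i)
    f-g u (s≤s u≤L) = trans (cong (λ x → f u - x) (sym (f≡g u u≤L))) (ℚP.+-inverseʳ (f u))

-- Bell polynomials

bellB-≤ : ∀ n k x → k ≤ n → bellB n k x ≡
  sumℚ (map (bellTerm n x) (filter (λ js → (vsum js ℕP.≟ k) ×-dec (wsum js ℕP.≟ n)) (vecs (n ∸ k ℕ.+ 1) k)))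
bellB-≤ n k x k≤n with n <? k
... | yes n<k = ⊥-elim (ℕP.<⇒≱ n<k k≤n)
... | no _    = refl

module BellCoefficients (x a : Series) (x≡i!a : ∀ s → x s * 1/[ s ]! ≡ a s) where

  monomial′≡monomialProduct : ∀ {L} s (js : Vec ℕ L) → monomial′ x s js ≡ monomialProduct a s js
  monomial′≡monomialProduct s []       = refl
  monomial′≡monomialProduct s (j ∷ js) = cong₂ (λ u v → (u ^ℚ j) * v) (x≡i!a s) (monomial′≡monomialProduct (suc s) js)

  bellTerm≡ : ∀ {L} n (js : Vec ℕ L) → bellTerm n x js ≡ ι (n !) * (1/factProd js * monomialProduct a 1 js)
  bellTerm≡ n js = begin
    (ℤ.+ (n !) / factProd js) {{factProd≢0 js}} * monomial′ x 1 js
      ≡⟨ cong₂ _*_ (/-ι (n !) (factProd js) {{factProd≢0 js}}) (monomial′≡monomialProduct 1 js) ⟩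
    (ι (n !) * 1/factProd js) * monomialProduct a 1 js
      ≡⟨ ℚP.*-assoc (ι (n !)) (1/factProd js) (monomialProduct a 1 js) ⟩
    ι (n !) * (1/factProd js * monomialProduct a 1 js) ∎

  bellB≡coefficient : ∀ n k → k ≤ n → ι (k !) * bellB n k x ≡ ι (n !) * (dropConst a ^ k) n
  bellB≡coefficient n k k≤n = begin
    ι (k !) * bellB n k x
      ≡⟨ cong (ι (k !) *_) (trans (bellB-≤ n k x k≤n) (sumℚ-filter P? (bellTerm n x) xs)) ⟩
    ι (k !) * sumℚ (map (λ js → 𝟙 (P? js) * bellTerm n x js) xs)
      ≡⟨ cong (ι (k !) *_) (sumℚ-cong (λ js → trans (cong (𝟙 (P? js) *_) (bellTerm≡ n js))
           (solve 3 (λ i N r → i :* (N :* r) := N :* (i :* r)) refl (𝟙 (P? js)) (ι (n !)) _)) xs) ⟩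
    ι (k !) * sumℚ (map (λ js → ι (n !) * multinomialTerm a 1 k n js) xs)
      ≡⟨ cong (ι (k !) *_) (sumℚ-*ˡ (ι (n !)) (multinomialTerm a 1 k n) xs) ⟩
    ι (k !) * (ι (n !) * multinomialSum a 1 L k k n)
      ≡⟨ solve 3 (λ K N E → K :* (N :* E) := N :* (K :* E)) refl (ι (k !)) (ι (n !)) (multinomialSum a 1 L k k n) ⟩
    ι (n !) * (ι (k !) * multinomialSum a 1 L k k n)
      ≡⟨ cong (ι (n !) *_) (multinomial-theorem a 1 L k k n ℕP.≤-refl) ⟩
    ι (n !) * (polynomial a 1 L ^ k) n
      ≡⟨ cong (ι (n !) *_) (^-agree L (polynomial-x^∣) (dropConst-x^∣ a) (polynomial-dropConst a L) k n n<L+k) ⟩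
    ι (n !) * (dropConst a ^ k) n ∎
    where
    open +-*-Solver
    L = n ∸ k ℕ.+ 1
    xs = vecs L k
    P? = λ (js : Vec ℕ L) → (vsum js ℕP.≟ k) ×-dec (wsum js ℕP.≟ n)
    polynomial-x^∣ : x^ 1 ∣ polynomial a 1 L
    polynomial-x^∣ zero    _        = polynomial-below a 1 L 0 (s≤s z≤n)
    polynomial-x^∣ (suc t) (s≤s ())
    n<L+k : n < L ℕ.+ k
    n<L+k = subst (n <_) (sym (trans (ℕP.+-assoc (n ∸ k) 1 k) (trans (ℕP.+-suc (n ∸ k) k) (cong suc (ℕP.m∸n+n≡m k≤n))))) (ℕP.n<1+n n)

  bellB≡θ-coefficient : ∀ n i → i < suc n →
    ι (i !) * bellB (suc n) (suc i) x ≡ ι (n !) * (dropConst a ^ i ⊛ θ (dropConst a)) (suc n)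
  bellB≡θ-coefficient n i i<n = ι-cancelˡ (suc i) (begin
    ι (suc i) * (ι (i !) * B)              ≡⟨ sym (ℚP.*-assoc (ι (suc i)) (ι (i !)) B) ⟩
    (ι (suc i) * ι (i !)) * B              ≡⟨ cong (_* B) (sym (ι-* (suc i) (i !))) ⟩
    ι (suc i !) * B                        ≡⟨ bellB≡coefficient (suc n) (suc i) i<n ⟩
    ι (suc n !) * (A ^ suc i) (suc n)      ≡⟨ cong (_* (A ^ suc i) (suc n)) (ι-* (suc n) (n !)) ⟩
    (ι (suc n) * ι (n !)) * (A ^ suc i) (suc n)
      ≡⟨ solve 3 (λ N F p → (N :* F) :* p := F :* (N :* p)) refl (ι (suc n)) (ι (n !)) ((A ^ suc i) (suc n)) ⟩
    ι (n !) * θ (A ^ suc i) (suc n)        ≡⟨ cong (ι (n !) *_) (θ-^ A i (suc n)) ⟩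
    ι (n !) * (ι (suc i) * W)              ≡⟨ solve 3 (λ F I w → F :* (I :* w) := I :* (F :* w)) refl (ι (n !)) (ι (suc i)) W ⟩
    ι (suc i) * (ι (n !) * W)              ∎)
    where
    open +-*-Solver
    A = dropConst a
    B = bellB (suc n) (suc i) x
    W = (A ^ i ⊛ θ A) (suc n)

  logDerivative≡bell : ∀ n → ι (n !) * logDerivative a (suc n) ≡
    ∑[ i < suc n ] (signℚ i * (ι (i !) * bellB (suc n) (suc i) x))
  logDerivative≡bell n = begin
    ι (n !) * ∑[ i < suc n ] (signℚ i * W i)      ≡⟨ sym (∑-*ˡ (suc n) (ι (n !)) (λ i → signℚ i * W i)) ⟩
    ∑[ i < suc n ] (ι (n !) * (signℚ i * W i))    ≡⟨ ∑-cong (suc n) (λ i i<n → trans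
                                                      (solve 3 (λ F s w → F :* (s :* w) := s :* (F :* w)) refl (ι (n !)) (signℚ i) (W i))
                                                      (cong (signℚ i *_) (sym (bellB≡θ-coefficient n i i<n)))) ⟩
    ∑[ i < suc n ] (signℚ i * (ι (i !) * bellB (suc n) (suc i) x)) ∎
    where
    open +-*-Solver
    W = λ i → (dropConst a ^ i ⊛ θ (dropConst a)) (suc n)

bellArgs≡i!partition : ∀ m s → bellArgs m s * 1/[ s ]! ≡ partitionSeries m s
bellArgs≡i!partition m s = begin
  ι (s ! ℕ.* partitionCount′ m s) * 1/[ s ]!   ≡⟨ cong (_* 1/[ s ]!) (ι-* (s !) (partitionCount′ m s)) ⟩
  (ι (s !) * partitionSeries m s) * 1/[ s ]!   ≡⟨ solve 3 (λ f p i → (f :* p) :* i := i :* (f :* p)) refl (ι (s !)) (partitionSeries m s) 1/[ s ]! ⟩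
  1/[ s ]! * (ι (s !) * partitionSeries m s)   ≡⟨ 1/ι*ι* (s !) {{s !≢0}} (partitionSeries m s) ⟩
  partitionSeries m s                          ∎
  where open +-*-Solver

divisorSeries≡logDerivative : ∀ m → divisorSeries m ≈ logDerivative (partitionSeries m)
divisorSeries≡logDerivative m = ⊛-cancelʳ refl (λ t →
  trans (sym (θ-partitionSeries m t)) (sym (logDerivative-⊛ (partitionSeries m) refl t)))

rhsSum-∑ : ∀ m n → rhsSum m n ≡ ∑[ i < n ] (signℚ i * (ι (i !) * bellB n (suc i) (bellArgs m)))
rhsSum-∑ m n = sumℚ-range (λ k → signℚ (k ∸ 1) * (ι ((k ∸ 1) !) * bellB n k (bellArgs m))) 1 n

-- Opened only here: in scope, +_ makes sections such as (x +_) ambiguous.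
open import Data.Integer using (+_)

corollary5 : (n m : ℕ) → 1 ≤ n → 3 ≤ m →
    (+ sigma′ m n / 1) ≡ (+ 1 / (n ∸ 1) !) {{(n ∸ 1) !≢0}} * rhsSum m n
-- Only the factorisation of the generating function matters, not which part sizes are
-- allowed.
corollary5 (suc n) m _ _ = begin
  divisorSeries m (suc n)                           ≡⟨ divisorSeries≡logDerivative m (suc n) ⟩
  logDerivative a (suc n)                           ≡⟨ sym (1/ι*ι* (n !) {{n !≢0}} _) ⟩
  1/[ n ]! * (ι (n !) * logDerivative a (suc n))    ≡⟨ cong (1/[ n ]! *_) (logDerivative≡bell n) ⟩
  1/[ n ]! * ∑[ i < suc n ] (signℚ i * (ι (i !) * bellB (suc n) (suc i) (bellArgs m)))
                                                    ≡⟨ cong (1/[ n ]! *_) (sym (rhsSum-∑ m (suc n))) ⟩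
  1/[ n ]! * rhsSum m (suc n)                       ∎
  where
  a = partitionSeries m
  open BellCoefficients (bellArgs m) a (bellArgs≡i!partition m)
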